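{- For $i=1,2$, let $G_i$ be an $r_i$-regular graph. Then $G_1\nabla G_2$ is $D^L$-integral if and only if both $G_1$ and $G_2$ are $A$-integral.
   Context: For a connected graph $G$, $D(G)$ is the distance matrix, $Tr(G)$ the diagonal matrix of row sums of $D(G)$, and $D^L(G)=Tr(G)-D(G)$. A graph is $D^L$-integral if all eigenvalues of $D^L(G)$ are integers, and $A$-integral if all eigenvalues of its adjacency matrix are integers. $G_1\nabla G_2$ is the join (disjoint union plus all edges between the two vertex sets). -}

module Defs where

open import Data.Bool using (Bool; true; false; _∧_; _∨_; not; if_then_else_)
open import Data.Nat as ℕ using (ℕ; zero; suc; _+_)
open import Data.Integer as ℤ using (ℤ; +_; -_)
open import Data.Fin using (Fin; zero; suc; toℕ; punchIn; splitAt)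
open import Data.Fin.Properties using (_≟_)
open import Data.Sum using (inj₁; inj₂)
open import Data.List using (List; []; _∷_; map)
open import Data.Vec using (Vec; []; _∷_)
open import Data.Product using (∃)
open import Relation.Binary.PropositionalEquality using (_≡_)
open import Relation.Nullary.Decidable using (⌊_⌋)

record Graph (n : ℕ) : Set where
  field
    adj       : Fin n → Fin n → Bool
    adj-sym   : ∀ u v → adj u v ≡ adj v u
    adj-irref : ∀ v → adj v v ≡ false
open Graph public

countF : ∀ {n} → (Fin n → Bool) → ℕ
countF {zero}  f = 0
countF {suc n} f = (if f zero then 1 else 0) + countF (λ i → f (suc i))

anyF : ∀ {n} → (Fin n → Bool) → Bool
anyF {zero}  f = false
anyF {suc n} f = f zero ∨ anyF (λ i → f (suc i))

degree : ∀ {n} → Graph n → Fin n → ℕ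
degree G v = countF (adj G v)

Regular : ∀ {n} → Graph n → ℕ → Set
Regular G r = ∀ v → degree G v ≡ r

join : ∀ {n₁ n₂} → Graph n₁ → Graph n₂ → Graph (n₁ + n₂)
join {n₁} {n₂} G₁ G₂ = record
  { adj = a ; adj-sym = s ; adj-irref = ir }
  where
  a' : _ → _ → Bool
  a' (inj₁ i) (inj₁ j) = adj G₁ i j
  a' (inj₂ i) (inj₂ j) = adj G₂ i j
  a' (inj₁ _) (inj₂ _) = true
  a' (inj₂ _) (inj₁ _) = true
  a : Fin (n₁ + n₂) → Fin (n₁ + n₂) → Bool
  a u v = a' (splitAt n₁ u) (splitAt n₁ v)
  s' : ∀ x y → a' x y ≡ a' y x
  s' (inj₁ i) (inj₁ j) = adj-sym G₁ i j
  s' (inj₂ i) (inj₂ j) = adj-sym G₂ i j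
  s' (inj₁ _) (inj₂ _) = Relation.Binary.PropositionalEquality.refl
  s' (inj₂ _) (inj₁ _) = Relation.Binary.PropositionalEquality.refl
  s : ∀ u v → a u v ≡ a v u
  s u v = s' (splitAt n₁ u) (splitAt n₁ v)
  ir' : ∀ x → a' x x ≡ false
  ir' (inj₁ i) = adj-irref G₁ i
  ir' (inj₂ i) = adj-irref G₂ i
  ir : ∀ v → a v v ≡ false
  ir v = ir' (splitAt n₁ v)

reach : ∀ {n} → Graph n → ℕ → Fin n → Fin n → Bool
reach G zero    u v = ⌊ u ≟ v ⌋
reach G (suc k) u v = reach G k u v ∨ anyF (λ w → adj G u w ∧ reach G k w v)

-- least k < fuel with f k, (fuel if none)
minFrom : ℕ → (ℕ → Bool) → ℕ
minFrom zero    f = 0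
minFrom (suc m) f = if f 0 then 0 else suc (minFrom m (λ k → f (suc k)))

-- shortest-path distance (meaningful for connected graphs, where it is < n)
dist : ∀ {n} → Graph n → Fin n → Fin n → ℕ
dist {n} G u v = minFrom n (λ k → reach G k u v)

Matrix : ℕ → Set
Matrix n = Fin n → Fin n → ℤ

δ : ∀ {n} → Fin n → Fin n → Bool
δ i j = ⌊ i ≟ j ⌋

sumZ : ∀ {n} → (Fin n → ℤ) → ℤ
sumZ {zero}  f = + 0
sumZ {suc n} f = f zero ℤ.+ sumZ (λ i → f (suc i))

adjMatrix : ∀ {n} → Graph n → Matrix n
adjMatrix G i j = if adj G i j then + 1 else + 0

distMatrix : ∀ {n} → Graph n → Matrix n
distMatrix G i j = + dist G i j

transmission : ∀ {n} → Graph n → Fin n → ℤ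
transmission G i = sumZ (distMatrix G i)

distLaplacian : ∀ {n} → Graph n → Matrix n
distLaplacian G i j = (if δ i j then transmission G i else + 0) ℤ.- distMatrix G i j

-- Integer polynomials (little-endian coefficient lists)

Poly : Set
Poly = List ℤ

_+ₚ_ : Poly → Poly → Poly
[] +ₚ q = q
(a ∷ p) +ₚ [] = a ∷ p
(a ∷ p) +ₚ (b ∷ q) = (a ℤ.+ b) ∷ (p +ₚ q)

scaleₚ : ℤ → Poly → Poly
scaleₚ c = map (c ℤ.*_)

_*ₚ_ : Poly → Poly → Poly
[] *ₚ q = []
(a ∷ p) *ₚ q = scaleₚ a q +ₚ (+ 0 ∷ (p *ₚ q))

negₚ : Poly → Poly
negₚ = map -_

constₚ : ℤ → Poly
constₚ c = c ∷ []

Xₚ : Poly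
Xₚ = + 0 ∷ + 1 ∷ []

coeff : Poly → ℕ → ℤ
coeff []      k       = + 0
coeff (a ∷ p) zero    = a
coeff (a ∷ p) (suc k) = coeff p k

_≈ₚ_ : Poly → Poly → Set
p ≈ₚ q = ∀ k → coeff p k ≡ coeff q k

sumₚ : ∀ {n} → (Fin n → Poly) → Poly
sumₚ {zero}  f = []
sumₚ {suc n} f = f zero +ₚ sumₚ (λ i → f (suc i))

sign : ℕ → Poly → Poly
sign zero          p = p
sign (suc zero)    p = negₚ p
sign (suc (suc k)) p = sign k p

detₚ : ∀ {n} → (Fin n → Fin n → Poly) → Poly
detₚ {zero}  M = constₚ (+ 1)
detₚ {suc n} M =
  sumₚ (λ j → sign (toℕ j) (M zero j *ₚ detₚ (λ i k → M (suc i) (punchIn j k))))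

charPoly : ∀ {n} → Matrix n → Poly
charPoly M = detₚ (λ i j → (if δ i j then Xₚ else []) +ₚ negₚ (constₚ (M i j)))

prodLinear : ∀ {n} → Vec ℤ n → Poly
prodLinear []       = constₚ (+ 1)
prodLinear (λ₀ ∷ ls) = (negₚ (constₚ λ₀) +ₚ Xₚ) *ₚ prodLinear ls

-- all eigenvalues (with multiplicity, over ℂ) of M are integers:
-- the characteristic polynomial splits as ∏ (x - λᵢ) with λᵢ ∈ ℤ
IntegralSpectrum : ∀ {n} → Matrix n → Set
IntegralSpectrum {n} M = ∃ λ (ls : Vec ℤ n) → charPoly M ≈ₚ prodLinear ls

A-integral : ∀ {n} → Graph n → Set
A-integral G = IntegralSpectrum (adjMatrix G)

DL-integral : ∀ {n} → Graph n → Set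
DL-integral G = IntegralSpectrum (distLaplacian G)

{-# OPTIONS --safe #-}

-- For regular G₁, G₂ (nᵢ vertices, degree rᵢ) the distance in G₁∇G₂ is 1 across the two
-- sides and 2 − A(Gᵢ) within a side, so xI − D^L(G₁∇G₂) is built from the blocks
-- Qᵢ = (x − aᵢ)I − A(Gᵢ), with a₁ = 2n₁ + n₂ − r₁ and symmetrically a₂. The row sums are
-- 0 for D^L and x − tᵢ for Qᵢ, where tᵢ = aᵢ + rᵢ; with Rᵢ the determinant of Qᵢ after
-- its first column is replaced by ones, column operations give
-- det(xI − D^L) = x (x − n₁ − n₂) R₁ R₂ and det Qᵢ = (x − tᵢ) Rᵢ. Since det Qᵢ is the
-- characteristic polynomial of A(Gᵢ) shifted by aᵢ, and a product of monic integer
-- polynomials splits into integral linear factors exactly when each factor does (factor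
-- theorem), D^L(G₁∇G₂) has integral spectrum iff both A(Gᵢ) do.

module Submission where

open import Defs
open import Level using (0ℓ)
open import Data.Nat as ℕ using (ℕ; zero; suc; _<_; _≤_; s≤s; z≤n)
import Data.Nat.Properties as ℕ
import Data.Nat.Tactic.RingSolver as ℕ
open import Data.Integer as ℤ using (ℤ; +_; -_)
import Data.Integer.Properties as ℤ
import Data.Integer.Tactic.RingSolver as ℤ
open import Tactic.RingSolver using (solve-∀)
import Tactic.RingSolver.Core.AlmostCommutativeRing as ACR
open import Algebra.Bundles using (CommutativeRing)
open import Data.Fin as Fin using (Fin; zero; suc; toℕ; punchIn; punchOut; inject₁; _↑ˡ_; _↑ʳ_; splitAt)
import Data.Fin.Properties as Fin
open import Data.Bool using (Bool; true; false; if_then_else_; _∨_; _∧_)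
import Data.Bool.Properties as Bool
open import Data.List using ([]; _∷_; length)
open import Data.Vec as Vec using (Vec; []; _∷_; _++_)
open import Data.Maybe using (Maybe; just; nothing)
open import Data.Sum using (_⊎_; inj₁; inj₂; [_,_]′)
open import Data.Product using (Σ; ∃; _×_; _,_; proj₁; proj₂)
open import Data.Product.Function.NonDependent.Propositional using (_×-⇔_)
open import Data.Empty using (⊥-elim)
open import Function using (_∘_)
open import Function.Bundles using (_⇔_; mk⇔)
open import Function.Properties.Equivalence using () renaming (trans to ⇔-trans; sym to ⇔-sym)
open import Relation.Nullary using (Dec; yes; no)
open import Relation.Nullary.Decidable using (⌊_⌋)
open import Relation.Binary.Bundles using (Setoid)
open import Relation.Binary.Structures using (IsEquivalence)
open import Relation.Binary.Definitions using (tri<; tri≈; tri>)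
open import Relation.Binary.PropositionalEquality
  using (_≡_; _≢_; refl; sym; trans; cong; cong₂; subst; subst₂; module ≡-Reasoning)
import Relation.Binary.Reasoning.Setoid as SetoidReasoning

-- Polynomials over ℤ

infix  4 _≈_
infixl 7 _*_
infixl 6 _+_

-- A record around _≈ₚ_, so that both polynomials can be inferred from an equation.
record _≈_ (p q : Poly) : Set where
  constructor mk≈
  field coeff-≡ : p ≈ₚ q
open _≈_

_+_ _*_ : Poly → Poly → Poly
_+_ = _+ₚ_
_*_ = _*ₚ_

1ₚ : Poly
1ₚ = constₚ (+ 1)

≈-refl : ∀ {p} → p ≈ p
≈-refl = mk≈ λ _ → refl

≈-sym : ∀ {p q} → p ≈ q → q ≈ p
≈-sym (mk≈ e) = mk≈ λ k → sym (e k)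

≈-trans : ∀ {p q r} → p ≈ q → q ≈ r → p ≈ r
≈-trans (mk≈ e) (mk≈ f) = mk≈ λ k → trans (e k) (f k)

≡⇒≈ : ∀ {p q} → p ≡ q → p ≈ q
≡⇒≈ refl = ≈-refl

≈-isEquivalence : IsEquivalence _≈_
≈-isEquivalence = record { refl = ≈-refl ; sym = ≈-sym ; trans = ≈-trans }

≈-setoid : Setoid 0ℓ 0ℓ
≈-setoid = record { isEquivalence = ≈-isEquivalence }

coeff-+ : ∀ p q k → coeff (p + q) k ≡ coeff p k ℤ.+ coeff q k
coeff-+ []      q       k       = sym (ℤ.+-identityˡ _)
coeff-+ (a ∷ p) []      k       = sym (ℤ.+-identityʳ _)
coeff-+ (a ∷ p) (b ∷ q) zero    = refl
coeff-+ (a ∷ p) (b ∷ q) (suc k) = coeff-+ p q k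

coeff-scale : ∀ a p k → coeff (scaleₚ a p) k ≡ a ℤ.* coeff p k
coeff-scale a []      k       = sym (ℤ.*-zeroʳ a)
coeff-scale a (b ∷ p) zero    = refl
coeff-scale a (b ∷ p) (suc k) = coeff-scale a p k

coeff-neg : ∀ p k → coeff (negₚ p) k ≡ - coeff p k
coeff-neg []      k       = refl
coeff-neg (b ∷ p) zero    = refl
coeff-neg (b ∷ p) (suc k) = coeff-neg p k

∷-cong : ∀ {a b p q} → a ≡ b → p ≈ q → (a ∷ p) ≈ (b ∷ q)
∷-cong a≡b (mk≈ p≈q) = mk≈ λ { zero → a≡b ; (suc k) → p≈q k }

0∷-zero : ∀ {p} → p ≈ [] → (+ 0 ∷ p) ≈ []
0∷-zero (mk≈ p≈0) = mk≈ λ { zero → refl ; (suc k) → p≈0 k }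

tail-≈ : ∀ {a b p q} → (a ∷ p) ≈ (b ∷ q) → p ≈ q
tail-≈ (mk≈ e) = mk≈ λ k → e (suc k)

tail-zero : ∀ {a p} → (a ∷ p) ≈ [] → p ≈ []
tail-zero (mk≈ e) = mk≈ λ k → e (suc k)

module _ where
  open ≡-Reasoning

  +-cong : ∀ {p p′ q q′} → p ≈ p′ → q ≈ q′ → p + q ≈ p′ + q′
  +-cong {p} {p′} {q} {q′} (mk≈ e) (mk≈ f) = mk≈ λ k → begin
    coeff (p + q) k            ≡⟨ coeff-+ p q k ⟩
    coeff p k ℤ.+ coeff q k    ≡⟨ cong₂ ℤ._+_ (e k) (f k) ⟩
    coeff p′ k ℤ.+ coeff q′ k  ≡⟨ coeff-+ p′ q′ k ⟨
    coeff (p′ + q′) k          ∎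

  +-congˡ : ∀ p {q q′} → q ≈ q′ → p + q ≈ p + q′
  +-congˡ p = +-cong (≈-refl {p})

  +-congʳ : ∀ {p p′} q → p ≈ p′ → p + q ≈ p′ + q
  +-congʳ q p≈p′ = +-cong p≈p′ (≈-refl {q})

  scale-cong : ∀ a {p q} → p ≈ q → scaleₚ a p ≈ scaleₚ a q
  scale-cong a {p} {q} (mk≈ e) = mk≈ λ k → begin
    coeff (scaleₚ a p) k  ≡⟨ coeff-scale a p k ⟩
    a ℤ.* coeff p k       ≡⟨ cong (a ℤ.*_) (e k) ⟩
    a ℤ.* coeff q k       ≡⟨ coeff-scale a q k ⟨
    coeff (scaleₚ a q) k  ∎

  neg-cong : ∀ {p q} → p ≈ q → negₚ p ≈ negₚ q
  neg-cong {p} {q} (mk≈ e) = mk≈ λ k → begin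
    coeff (negₚ p) k  ≡⟨ coeff-neg p k ⟩
    - coeff p k       ≡⟨ cong -_ (e k) ⟩
    - coeff q k       ≡⟨ coeff-neg q k ⟨
    coeff (negₚ q) k  ∎

  +-comm : ∀ p q → p + q ≈ q + p
  +-comm p q = mk≈ λ k → begin
    coeff (p + q) k          ≡⟨ coeff-+ p q k ⟩
    coeff p k ℤ.+ coeff q k  ≡⟨ ℤ.+-comm (coeff p k) _ ⟩
    coeff q k ℤ.+ coeff p k  ≡⟨ coeff-+ q p k ⟨
    coeff (q + p) k          ∎

  +-assoc : ∀ p q r → (p + q) + r ≈ p + (q + r)
  +-assoc p q r = mk≈ λ k → begin
    coeff ((p + q) + r) k                        ≡⟨ coeff-+ (p + q) r k ⟩
    coeff (p + q) k ℤ.+ coeff r k                ≡⟨ cong (ℤ._+ coeff r k) (coeff-+ p q k) ⟩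
    (coeff p k ℤ.+ coeff q k) ℤ.+ coeff r k      ≡⟨ ℤ.+-assoc (coeff p k) _ _ ⟩
    coeff p k ℤ.+ (coeff q k ℤ.+ coeff r k)      ≡⟨ cong (ℤ._+_ (coeff p k)) (coeff-+ q r k) ⟨
    coeff p k ℤ.+ coeff (q + r) k                ≡⟨ coeff-+ p (q + r) k ⟨
    coeff (p + (q + r)) k                        ∎

  +-identityʳ : ∀ p → p + [] ≈ p
  +-identityʳ p = mk≈ λ k → trans (coeff-+ p [] k) (ℤ.+-identityʳ _)

  -‿inverseˡ : ∀ p → negₚ p + p ≈ []
  -‿inverseˡ p = mk≈ λ k → begin
    coeff (negₚ p + p) k            ≡⟨ coeff-+ (negₚ p) p k ⟩
    coeff (negₚ p) k ℤ.+ coeff p k  ≡⟨ cong (ℤ._+ coeff p k) (coeff-neg p k) ⟩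
    - coeff p k ℤ.+ coeff p k       ≡⟨ ℤ.+-inverseˡ (coeff p k) ⟩
    + 0                             ∎

  -‿inverseʳ : ∀ p → p + negₚ p ≈ []
  -‿inverseʳ p = ≈-trans (+-comm p (negₚ p)) (-‿inverseˡ p)

  scale-distribˡ : ∀ a p q → scaleₚ a (p + q) ≈ scaleₚ a p + scaleₚ a q
  scale-distribˡ a p q = mk≈ λ k → begin
    coeff (scaleₚ a (p + q)) k                    ≡⟨ coeff-scale a (p + q) k ⟩
    a ℤ.* coeff (p + q) k                         ≡⟨ cong (a ℤ.*_) (coeff-+ p q k) ⟩
    a ℤ.* (coeff p k ℤ.+ coeff q k)               ≡⟨ ℤ.*-distribˡ-+ a (coeff p k) _ ⟩
    a ℤ.* coeff p k ℤ.+ a ℤ.* coeff q k           ≡⟨ cong₂ ℤ._+_ (coeff-scale a p k) (coeff-scale a q k) ⟨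
    coeff (scaleₚ a p) k ℤ.+ coeff (scaleₚ a q) k ≡⟨ coeff-+ (scaleₚ a p) (scaleₚ a q) k ⟨
    coeff (scaleₚ a p + scaleₚ a q) k             ∎

  scale-distribʳ : ∀ a b p → scaleₚ (a ℤ.+ b) p ≈ scaleₚ a p + scaleₚ b p
  scale-distribʳ a b p = mk≈ λ k → begin
    coeff (scaleₚ (a ℤ.+ b) p) k                  ≡⟨ coeff-scale (a ℤ.+ b) p k ⟩
    (a ℤ.+ b) ℤ.* coeff p k                       ≡⟨ ℤ.*-distribʳ-+ (coeff p k) a b ⟩
    a ℤ.* coeff p k ℤ.+ b ℤ.* coeff p k           ≡⟨ cong₂ ℤ._+_ (coeff-scale a p k) (coeff-scale b p k) ⟨
    coeff (scaleₚ a p) k ℤ.+ coeff (scaleₚ b p) k ≡⟨ coeff-+ (scaleₚ a p) (scaleₚ b p) k ⟨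
    coeff (scaleₚ a p + scaleₚ b p) k             ∎

  scale-zero : ∀ p → scaleₚ (+ 0) p ≈ []
  scale-zero p = mk≈ (coeff-scale (+ 0) p)

  scale-identity : ∀ p → scaleₚ (+ 1) p ≈ p
  scale-identity p = mk≈ λ k → trans (coeff-scale (+ 1) p k) (ℤ.*-identityˡ _)

  scale-scale : ∀ a b p → scaleₚ a (scaleₚ b p) ≈ scaleₚ (a ℤ.* b) p
  scale-scale a b p = mk≈ λ k → begin
    coeff (scaleₚ a (scaleₚ b p)) k  ≡⟨ coeff-scale a (scaleₚ b p) k ⟩
    a ℤ.* coeff (scaleₚ b p) k       ≡⟨ cong (a ℤ.*_) (coeff-scale b p k) ⟩
    a ℤ.* (b ℤ.* coeff p k)          ≡⟨ ℤ.*-assoc a b _ ⟨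
    a ℤ.* b ℤ.* coeff p k            ≡⟨ coeff-scale (a ℤ.* b) p k ⟨
    coeff (scaleₚ (a ℤ.* b) p) k     ∎

  +-interchange : ∀ p q r s → (p + q) + (r + s) ≈ (p + r) + (q + s)
  +-interchange p q r s = mk≈ λ k → begin
    coeff ((p + q) + (r + s)) k
      ≡⟨ coeff-+ (p + q) _ k ⟩
    coeff (p + q) k ℤ.+ coeff (r + s) k
      ≡⟨ cong₂ ℤ._+_ (coeff-+ p q k) (coeff-+ r s k) ⟩
    (coeff p k ℤ.+ coeff q k) ℤ.+ (coeff r k ℤ.+ coeff s k)
      ≡⟨ interchange (coeff p k) (coeff q k) (coeff r k) (coeff s k) ⟩
    (coeff p k ℤ.+ coeff r k) ℤ.+ (coeff q k ℤ.+ coeff s k)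
      ≡⟨ cong₂ ℤ._+_ (coeff-+ p r k) (coeff-+ q s k) ⟨
    coeff (p + r) k ℤ.+ coeff (q + s) k
      ≡⟨ coeff-+ (p + r) _ k ⟨
    coeff ((p + r) + (q + s)) k ∎
    where
    interchange : ∀ a b c d → (a ℤ.+ b) ℤ.+ (c ℤ.+ d) ≡ (a ℤ.+ c) ℤ.+ (b ℤ.+ d)
    interchange = solve-∀ ℤ.ring

*-congˡ : ∀ p {q q′} → q ≈ q′ → p * q ≈ p * q′
*-congˡ []      q≈q′ = ≈-refl
*-congˡ (a ∷ p) q≈q′ = +-cong (scale-cong a q≈q′) (∷-cong refl (*-congˡ p q≈q′))

zero-* : ∀ {p} q → p ≈ [] → p * q ≈ []
zero-* {[]}    q p≈0 = ≈-refl
zero-* {a ∷ p} q p≈0 = ≈-trans (+-cong a*q≈0 (0∷-zero (zero-* q (tail-zero p≈0)))) ≈-refl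
  where
  a*q≈0 : scaleₚ a q ≈ []
  a*q≈0 rewrite coeff-≡ p≈0 zero = scale-zero q

*-congʳ : ∀ {p p′} q → p ≈ p′ → p * q ≈ p′ * q
*-congʳ {[]}    {p′}     q p≈p′ = ≈-sym (zero-* q (≈-sym p≈p′))
*-congʳ {a ∷ p} {[]}     q p≈p′ = zero-* q p≈p′
*-congʳ {a ∷ p} {b ∷ p′} q p≈p′ rewrite coeff-≡ p≈p′ zero =
  +-cong ≈-refl (∷-cong refl (*-congʳ q (tail-≈ p≈p′)))

*-cong : ∀ {p p′ q q′} → p ≈ p′ → q ≈ q′ → p * q ≈ p′ * q′
*-cong {p′ = p′} {q} p≈p′ q≈q′ = ≈-trans (*-congʳ q p≈p′) (*-congˡ p′ q≈q′)

*-zeroʳ : ∀ p → p * [] ≈ []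
*-zeroʳ []      = ≈-refl
*-zeroʳ (a ∷ p) = 0∷-zero (*-zeroʳ p)

*-distribˡ : ∀ p q r → p * (q + r) ≈ p * q + p * r
*-distribˡ []      q r = ≈-refl
*-distribˡ (a ∷ p) q r =
  ≈-trans (+-cong (scale-distribˡ a q r) (∷-cong refl (*-distribˡ p q r)))
          (+-interchange (scaleₚ a q) (scaleₚ a r) (+ 0 ∷ p * q) (+ 0 ∷ p * r))

*-distribʳ : ∀ p q r → (p + q) * r ≈ p * r + q * r
*-distribʳ []      q       r = ≈-refl
*-distribʳ (a ∷ p) []      r = ≈-sym (+-identityʳ _)
*-distribʳ (a ∷ p) (b ∷ q) r =
  ≈-trans (+-cong (scale-distribʳ a b r) (∷-cong refl (*-distribʳ p q r)))
          (+-interchange (scaleₚ a r) (scaleₚ b r) (+ 0 ∷ p * r) (+ 0 ∷ q * r))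

scale-* : ∀ a q r → scaleₚ a q * r ≈ scaleₚ a (q * r)
scale-* a []      r = ≈-refl
scale-* a (b ∷ q) r =
  ≈-trans (+-cong (≈-sym (scale-scale a b r)) (∷-cong (sym (ℤ.*-zeroʳ a)) (scale-* a q r)))
          (≈-sym (scale-distribˡ a (scaleₚ b r) (+ 0 ∷ q * r)))

*-assoc : ∀ p q r → (p * q) * r ≈ p * (q * r)
*-assoc []      q r = ≈-refl
*-assoc (a ∷ p) q r =
  ≈-trans (*-distribʳ (scaleₚ a q) (+ 0 ∷ p * q) r)
          (+-cong (scale-* a q r) (≈-trans (+-cong (scale-zero r) ≈-refl) (∷-cong refl (*-assoc p q r))))

*-∷ : ∀ p b q → p * (b ∷ q) ≈ scaleₚ b p + (+ 0 ∷ p * q)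
*-∷ []      b q = ≈-sym (0∷-zero ≈-refl)
*-∷ (a ∷ p) b q =
  ∷-cong (ab≡ba a b)
    (≈-trans (+-cong ≈-refl (*-∷ p b q))
    (≈-trans (≈-sym (+-assoc (scaleₚ a q) (scaleₚ b p) _))
    (≈-trans (+-cong (+-comm (scaleₚ a q) (scaleₚ b p)) ≈-refl)
             (+-assoc (scaleₚ b p) (scaleₚ a q) _))))
  where
  ab≡ba : ∀ a b → a ℤ.* b ℤ.+ + 0 ≡ b ℤ.* a ℤ.+ + 0
  ab≡ba = solve-∀ ℤ.ring

*-comm : ∀ p q → p * q ≈ q * p
*-comm []      q = ≈-sym (*-zeroʳ q)
*-comm (a ∷ p) q = ≈-trans (+-cong ≈-refl (∷-cong refl (*-comm p q))) (≈-sym (*-∷ q a p))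

*-identityˡ : ∀ p → 1ₚ * p ≈ p
*-identityˡ p = ≈-trans (+-cong (scale-identity p) (0∷-zero ≈-refl)) (+-identityʳ p)

*-identityʳ : ∀ p → p * 1ₚ ≈ p
*-identityʳ p = ≈-trans (*-comm p _) (*-identityˡ p)

Poly-commutativeRing : CommutativeRing 0ℓ 0ℓ
Poly-commutativeRing = record
  { Carrier = Poly ; _≈_ = _≈_ ; _+_ = _+_ ; _*_ = _*_ ; -_ = negₚ ; 0# = [] ; 1# = 1ₚ
  ; isCommutativeRing = record
    { isRing = record
      { +-isAbelianGroup = record
        { isGroup = record
          { isMonoid = record
            { isSemigroup = record
              { isMagma = record { isEquivalence = ≈-isEquivalence ; ∙-cong = +-cong }
              ; assoc = +-assoc }
            ; identity = (λ _ → ≈-refl) , +-identityʳ }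
          ; inverse = -‿inverseˡ , -‿inverseʳ
          ; ⁻¹-cong = neg-cong }
        ; comm = +-comm }
      ; *-cong = *-cong
      ; *-assoc = *-assoc
      ; *-identity = *-identityˡ , *-identityʳ
      ; distrib = *-distribˡ , λ r p q → *-distribʳ p q r }
    ; *-comm = *-comm } }

≈[]? : (p : Poly) → Maybe ([] ≈ p)
≈[]? []          = just ≈-refl
≈[]? (+ 0 ∷ p)  with ≈[]? p
... | just 0≈p  = just (≈-sym (0∷-zero (≈-sym 0≈p)))
... | nothing   = nothing
≈[]? (_ ∷ p)    = nothing

Poly-ring : ACR.AlmostCommutativeRing 0ℓ 0ℓ
Poly-ring = ACR.fromCommutativeRing Poly-commutativeRing ≈[]?

neg-involutive : ∀ p → negₚ (negₚ p) ≈ p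
neg-involutive = solve-∀ Poly-ring

neg-distrib-+ : ∀ p q → negₚ (p + q) ≈ negₚ p + negₚ q
neg-distrib-+ = solve-∀ Poly-ring

neg-distribʳ-* : ∀ p q → negₚ (p * q) ≈ p * negₚ q
neg-distribʳ-* = solve-∀ Poly-ring

+≈0⇒≈neg : ∀ p q → p + q ≈ [] → q ≈ negₚ p
+≈0⇒≈neg p q p+q≈0 =
  ≈-trans (regroup p q) (≈-trans (+-congˡ (negₚ p) p+q≈0) (+-identityʳ (negₚ p)))
  where
  regroup : ∀ p q → q ≈ negₚ p + (p + q)
  regroup = solve-∀ Poly-ring

-- Linear factors, composition and evaluation

open SetoidReasoning ≈-setoid

infix 10 X-_
infixl 9 _∘ₚ_

X-_ : ℤ → Poly
X- c = negₚ (constₚ c) + Xₚ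

const-* : ∀ a b → constₚ (a ℤ.* b) ≈ constₚ a * constₚ b
const-* a b = ∷-cong (sym (ℤ.+-identityʳ _)) ≈-refl

const-zero : constₚ (+ 0) ≈ []
const-zero = 0∷-zero ≈-refl

X-+const : ∀ a b → X- a + constₚ b ≈ X- (a ℤ.- b)
X-+const a b = ∷-cong (shift a b) ≈-refl
  where
  shift : ∀ a b → - a ℤ.+ + 0 ℤ.+ b ≡ - (a ℤ.- b) ℤ.+ + 0
  shift = solve-∀ ℤ.ring

X-+const₂ : ∀ a b c → X- a + constₚ b + constₚ c ≈ X- (a ℤ.- b ℤ.- c)
X-+const₂ a b c = ≈-trans (+-congʳ (constₚ c) (X-+const a b)) (X-+const (a ℤ.- b) c)

_∘ₚ_ : Poly → Poly → Poly
[]      ∘ₚ q = []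
(a ∷ p) ∘ₚ q = constₚ a + q * (p ∘ₚ q)

zero-∘ : ∀ {p} q → p ≈ [] → p ∘ₚ q ≈ []
zero-∘ {[]}    q p≈0 = ≈-refl
zero-∘ {a ∷ p} q p≈0 rewrite coeff-≡ p≈0 zero =
  ≈-trans (+-cong const-zero (≈-trans (*-congˡ q (zero-∘ q (tail-zero p≈0))) (*-zeroʳ q))) ≈-refl

∘-congʳ : ∀ {p p′} q → p ≈ p′ → p ∘ₚ q ≈ p′ ∘ₚ q
∘-congʳ {[]}    q p≈p′ = ≈-sym (zero-∘ q (≈-sym p≈p′))
∘-congʳ {a ∷ p} {[]} q p≈p′ = zero-∘ q p≈p′
∘-congʳ {a ∷ p} {b ∷ p′} q p≈p′ rewrite coeff-≡ p≈p′ zero =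
  +-cong ≈-refl (*-congˡ q (∘-congʳ q (tail-≈ p≈p′)))

∘-congˡ : ∀ p {q q′} → q ≈ q′ → p ∘ₚ q ≈ p ∘ₚ q′
∘-congˡ []      q≈q′ = ≈-refl
∘-congˡ (a ∷ p) q≈q′ = +-cong ≈-refl (*-cong q≈q′ (∘-congˡ p q≈q′))

∘-+ : ∀ p p′ q → (p + p′) ∘ₚ q ≈ p ∘ₚ q + p′ ∘ₚ q
∘-+ []      p′       q = ≈-refl
∘-+ (a ∷ p) []       q = ≈-sym (+-identityʳ _)
∘-+ (a ∷ p) (b ∷ p′) q =
  ≈-trans (+-cong ≈-refl (*-congˡ q (∘-+ p p′ q)))
          (shuffle (constₚ a) (constₚ b) q (p ∘ₚ q) (p′ ∘ₚ q))
  where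
  shuffle : ∀ a b q x y → (a + b) + q * (x + y) ≈ (a + q * x) + (b + q * y)
  shuffle = solve-∀ Poly-ring

∘-scale : ∀ a p q → scaleₚ a p ∘ₚ q ≈ constₚ a * (p ∘ₚ q)
∘-scale a []      q = ≈-sym (*-zeroʳ (constₚ a))
∘-scale a (b ∷ p) q =
  ≈-trans (+-cong (const-* a b) (*-congˡ q (∘-scale a p q)))
          (factor-out (constₚ a) (constₚ b) q (p ∘ₚ q))
  where
  factor-out : ∀ a b q x → a * b + q * (a * x) ≈ a * (b + q * x)
  factor-out = solve-∀ Poly-ring

∘-* : ∀ p p′ q → (p * p′) ∘ₚ q ≈ p ∘ₚ q * (p′ ∘ₚ q)
∘-* []      p′ q = ≈-refl
∘-* (a ∷ p) p′ q = begin
  (scaleₚ a p′ + (+ 0 ∷ p * p′)) ∘ₚ q                  ≈⟨ ∘-+ (scaleₚ a p′) (+ 0 ∷ p * p′) q ⟩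
  scaleₚ a p′ ∘ₚ q + (constₚ (+ 0) + q * ((p * p′) ∘ₚ q))
    ≈⟨ +-cong (∘-scale a p′ q) (+-cong const-zero (*-congˡ q (∘-* p p′ q))) ⟩
  constₚ a * (p′ ∘ₚ q) + q * (p ∘ₚ q * (p′ ∘ₚ q))      ≈⟨ regroup (constₚ a) q (p ∘ₚ q) (p′ ∘ₚ q) ⟩
  (constₚ a + q * (p ∘ₚ q)) * (p′ ∘ₚ q)                ∎
  where
  regroup : ∀ a q x y → a * y + q * (x * y) ≈ (a + q * x) * y
  regroup = solve-∀ Poly-ring

∘-neg : ∀ p q → negₚ p ∘ₚ q ≈ negₚ (p ∘ₚ q)
∘-neg []      q = ≈-refl
∘-neg (a ∷ p) q = ≈-trans (+-cong ≈-refl (*-congˡ q (∘-neg p q))) (neg-out (constₚ a) q (p ∘ₚ q))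
  where
  neg-out : ∀ a q x → negₚ a + q * negₚ x ≈ negₚ (a + q * x)
  neg-out = solve-∀ Poly-ring

const-∘ : ∀ c q → constₚ c ∘ₚ q ≈ constₚ c
const-∘ c q = ≈-trans (+-cong ≈-refl (*-zeroʳ q)) (+-identityʳ _)

Xₚ-∘ : ∀ q → Xₚ ∘ₚ q ≈ q
Xₚ-∘ q = ≈-trans (+-cong const-zero (*-congˡ q (const-∘ (+ 1) q))) (*-identityʳ q)

X*-shift : ∀ p → Xₚ * p ≈ (+ 0 ∷ p)
X*-shift p = +-cong (scale-zero p) (∷-cong refl (*-identityˡ p))

∘-Xₚ : ∀ p → p ∘ₚ Xₚ ≈ p
∘-Xₚ []      = ≈-refl
∘-Xₚ (a ∷ p) = ≈-trans (+-congˡ (constₚ a) (≈-trans (*-congˡ Xₚ (∘-Xₚ p)) (X*-shift p)))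
                      (∷-cong (ℤ.+-identityʳ a) ≈-refl)

∘-assoc : ∀ p q r → (p ∘ₚ q) ∘ₚ r ≈ p ∘ₚ (q ∘ₚ r)
∘-assoc []      q r = ≈-refl
∘-assoc (a ∷ p) q r =
  ≈-trans (∘-+ (constₚ a) (q * (p ∘ₚ q)) r)
          (+-cong (const-∘ a r) (≈-trans (∘-* q (p ∘ₚ q) r) (*-congˡ (q ∘ₚ r) (∘-assoc p q r))))

X-∘ : ∀ c q → X- c ∘ₚ q ≈ negₚ (constₚ c) + q
X-∘ c q = ≈-trans (∘-+ (negₚ (constₚ c)) Xₚ q)
                   (+-cong (≈-trans (∘-neg (constₚ c) q) (neg-cong (const-∘ c q))) (Xₚ-∘ q))

X-∘X- : ∀ c a → X- c ∘ₚ X- a ≈ X- (c ℤ.+ a)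
X-∘X- c a = ≈-trans (X-∘ c (X- a)) (∷-cong (shift c a) ≈-refl)
  where
  shift : ∀ c a → - c ℤ.+ (- a ℤ.+ + 0) ≡ - (c ℤ.+ a) ℤ.+ + 0
  shift = solve-∀ ℤ.ring

prodLinear-∘-X- : ∀ {n} (ls : Vec ℤ n) a →
                  prodLinear ls ∘ₚ X- a ≈ prodLinear (Vec.map (ℤ._+ a) ls)
prodLinear-∘-X- []       a = const-∘ (+ 1) (X- a)
prodLinear-∘-X- (μ ∷ ls) a =
  ≈-trans (∘-* (X- μ) (prodLinear ls) (X- a)) (*-cong (X-∘X- μ a) (prodLinear-∘-X- ls a))

∘X-inverse : ∀ p a → (p ∘ₚ X- a) ∘ₚ X- (- a) ≈ p
∘X-inverse p a = begin
  (p ∘ₚ X- a) ∘ₚ X- (- a)  ≈⟨ ∘-assoc p (X- a) (X- (- a)) ⟩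
  p ∘ₚ (X- a ∘ₚ X- (- a))  ≈⟨ ∘-congˡ p (X-∘X- a (- a)) ⟩
  p ∘ₚ X- (a ℤ.+ - a)      ≡⟨ cong (λ c → p ∘ₚ X- c) (ℤ.+-inverseʳ a) ⟩
  p ∘ₚ Xₚ                  ≈⟨ ∘-Xₚ p ⟩
  p                        ∎

prodLinear-++ : ∀ {m n} (xs : Vec ℤ m) (ys : Vec ℤ n) →
                prodLinear (xs ++ ys) ≈ prodLinear xs * prodLinear ys
prodLinear-++ []       ys = ≈-sym (*-identityˡ (prodLinear ys))
prodLinear-++ (x ∷ xs) ys =
  ≈-trans (*-congˡ (X- x) (prodLinear-++ xs ys)) (≈-sym (*-assoc (X- x) (prodLinear xs) (prodLinear ys)))

eval : Poly → ℤ → ℤ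
eval []      c = + 0
eval (a ∷ p) c = a ℤ.+ c ℤ.* eval p c

eval-zero : ∀ {p} c → p ≈ [] → eval p c ≡ + 0
eval-zero {[]}    c p≈0 = refl
eval-zero {a ∷ p} c p≈0 rewrite coeff-≡ p≈0 zero | eval-zero c (tail-zero p≈0) =
  cong (ℤ._+_ (+ 0)) (ℤ.*-zeroʳ c)

eval-cong : ∀ {p q} c → p ≈ q → eval p c ≡ eval q c
eval-cong {[]}    c p≈q = sym (eval-zero c (≈-sym p≈q))
eval-cong {a ∷ p} {[]} c p≈q = eval-zero c p≈q
eval-cong {a ∷ p} {b ∷ q} c p≈q =
  cong₂ (λ x y → x ℤ.+ c ℤ.* y) (coeff-≡ p≈q zero) (eval-cong c (tail-≈ p≈q))

eval-+ : ∀ p q c → eval (p + q) c ≡ eval p c ℤ.+ eval q c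
eval-+ []      q       c = sym (ℤ.+-identityˡ _)
eval-+ (a ∷ p) []      c = sym (ℤ.+-identityʳ _)
eval-+ (a ∷ p) (b ∷ q) c rewrite eval-+ p q c = regroup a b c (eval p c) (eval q c)
  where
  regroup : ∀ a b c x y → a ℤ.+ b ℤ.+ c ℤ.* (x ℤ.+ y) ≡ a ℤ.+ c ℤ.* x ℤ.+ (b ℤ.+ c ℤ.* y)
  regroup = solve-∀ ℤ.ring

eval-scale : ∀ a p c → eval (scaleₚ a p) c ≡ a ℤ.* eval p c
eval-scale a []      c = sym (ℤ.*-zeroʳ a)
eval-scale a (b ∷ p) c rewrite eval-scale a p c = factor-out a b c (eval p c)
  where
  factor-out : ∀ a b c x → a ℤ.* b ℤ.+ c ℤ.* (a ℤ.* x) ≡ a ℤ.* (b ℤ.+ c ℤ.* x)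
  factor-out = solve-∀ ℤ.ring

eval-* : ∀ p q c → eval (p * q) c ≡ eval p c ℤ.* eval q c
eval-* []      q c = refl
eval-* (a ∷ p) q c
  rewrite eval-+ (scaleₚ a q) (+ 0 ∷ p * q) c | eval-scale a q c | eval-* p q c =
  regroup a c (eval p c) (eval q c)
  where
  regroup : ∀ a c x y → a ℤ.* y ℤ.+ (+ 0 ℤ.+ c ℤ.* (x ℤ.* y)) ≡ (a ℤ.+ c ℤ.* x) ℤ.* y
  regroup = solve-∀ ℤ.ring

eval-X- : ∀ μ c → eval (X- μ) c ≡ c ℤ.- μ
eval-X- = simplify
  where
  simplify : ∀ μ c → - μ ℤ.+ + 0 ℤ.+ c ℤ.* (+ 1 ℤ.+ c ℤ.* + 0) ≡ c ℤ.- μ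
  simplify = solve-∀ ℤ.ring

eval-X-self : ∀ μ → eval (X- μ) μ ≡ + 0
eval-X-self μ = trans (eval-X- μ μ) (ℤ.+-inverseʳ μ)

eval-one : ∀ c → eval (1ₚ) c ≡ + 1
eval-one c rewrite ℤ.*-zeroʳ c = refl

quotient : Poly → ℤ → Poly
quotient []      c = []
quotient (a ∷ p) c = eval p c ∷ quotient p c

∷-≈ : ∀ a p → (a ∷ p) ≈ constₚ a + Xₚ * p
∷-≈ a p = ≈-trans (∷-cong (sym (ℤ.+-identityʳ a)) ≈-refl) (+-congˡ (constₚ a) (≈-sym (X*-shift p)))

division : ∀ p c → p ≈ X- c * quotient p c + constₚ (eval p c)
division []      c = ≈-sym (≈-trans (+-cong (*-zeroʳ (X- c)) ≈-refl) const-zero)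
division (a ∷ p) c = begin
  a ∷ p
    ≈⟨ ∷-≈ a p ⟩
  constₚ a + Xₚ * p
    ≈⟨ +-congˡ (constₚ a) (*-congˡ Xₚ (division p c)) ⟩
  constₚ a + Xₚ * (X- c * quotient p c + constₚ (eval p c))
    ≈⟨ regroup (constₚ a) (constₚ c) (quotient p c) (constₚ (eval p c)) ⟩
  X- c * (constₚ (eval p c) + Xₚ * quotient p c) + (constₚ a + constₚ c * constₚ (eval p c))
    ≈⟨ +-cong (*-congˡ (X- c) (≈-sym (∷-≈ (eval p c) (quotient p c))))
              (+-congˡ (constₚ a) (≈-sym (const-* c (eval p c)))) ⟩
  X- c * quotient (a ∷ p) c + constₚ (eval (a ∷ p) c)          ∎
  where
  regroup : ∀ a c q e → a + Xₚ * ((negₚ c + Xₚ) * q + e) ≈ (negₚ c + Xₚ) * (e + Xₚ * q) + (a + c * e)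
  regroup = solve-∀ Poly-ring

factor-theorem : ∀ p c → eval p c ≡ + 0 → p ≈ X- c * quotient p c
factor-theorem p c pc≡0 = begin
  p                                               ≈⟨ division p c ⟩
  X- c * quotient p c + constₚ (eval p c)         ≡⟨ cong (λ r → X- c * quotient p c + constₚ r) pc≡0 ⟩
  X- c * quotient p c + constₚ (+ 0)              ≈⟨ +-congˡ (X- c * quotient p c) const-zero ⟩
  X- c * quotient p c + []                        ≈⟨ +-identityʳ _ ⟩
  X- c * quotient p c                             ∎

coeff-X-* : ∀ c p k → coeff (X- c * p) (suc k) ≡ coeff p k ℤ.- c ℤ.* coeff p (suc k)
coeff-X-* c p k =
  trans (coeff-+ (scaleₚ (- c ℤ.+ + 0) p) _ (suc k))
  (trans (cong₂ ℤ._+_ (coeff-scale (- c ℤ.+ + 0) p (suc k))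
                      (trans (coeff-+ (scaleₚ (+ 1) p) _ k)
                             (cong₂ ℤ._+_ (coeff-scale (+ 1) p k) (coeff-≡ (0∷-zero ≈-refl) k))))
         (simplify c (coeff p (suc k)) (coeff p k)))
  where
  simplify : ∀ c x y → (- c ℤ.+ + 0) ℤ.* x ℤ.+ (+ 1 ℤ.* y ℤ.+ + 0) ≡ y ℤ.- c ℤ.* x
  simplify = solve-∀ ℤ.ring

coeff-beyond-length : ∀ p k → length p ≤ k → coeff p k ≡ + 0
coeff-beyond-length []      k       _         = refl
coeff-beyond-length (a ∷ p) (suc k) (s≤s len≤k) = coeff-beyond-length p k len≤k

-- If (X - c) p = 0 then each coefficient of p is c times the next one, and those
-- beyond the length of p vanish.
X-*≈0⇒≈0 : ∀ c p → X- c * p ≈ [] → p ≈ []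
X-*≈0⇒≈0 c p cp≈0 = mk≈ λ k → vanish (length p) k (ℕ.m≤n+m (length p) k)
  where
  recurrence : ∀ k → coeff p k ≡ c ℤ.* coeff p (suc k)
  recurrence k = ℤ.i-j≡0⇒i≡j _ _ (trans (sym (coeff-X-* c p k)) (coeff-≡ cp≈0 (suc k)))
  vanish : ∀ j k → length p ≤ k ℕ.+ j → coeff p k ≡ + 0
  vanish zero    k len≤ = coeff-beyond-length p k (subst (length p ≤_) (ℕ.+-identityʳ k) len≤)
  vanish (suc j) k len≤ =
    trans (recurrence k)
          (trans (cong (c ℤ.*_) (vanish j (suc k) (subst (length p ≤_) (ℕ.+-suc k j) len≤)))
                 (ℤ.*-zeroʳ c))

*-cancelˡ-X- : ∀ c p q → X- c * p ≈ X- c * q → p ≈ q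
*-cancelˡ-X- c p q cp≈cq = begin
  p                      ≈⟨ sub-add p q ⟨
  (p + negₚ q) + q       ≈⟨ +-cong (X-*≈0⇒≈0 c (p + negₚ q) c[p-q]≈0) ≈-refl ⟩
  q                      ∎
  where
  sub-add : ∀ p q → (p + negₚ q) + q ≈ p
  sub-add = solve-∀ Poly-ring
  distrib : ∀ l p q → l * (p + negₚ q) ≈ l * p + negₚ (l * q)
  distrib = solve-∀ Poly-ring
  c[p-q]≈0 : X- c * (p + negₚ q) ≈ []
  c[p-q]≈0 = ≈-trans (distrib (X- c) p q) (≈-trans (+-cong cp≈cq ≈-refl) (-‿inverseʳ (X- c * q)))

prodLinear-root : ∀ {m} (ls : Vec ℤ (suc m)) c → eval (prodLinear ls) c ≡ + 0 →
                  Σ (Vec ℤ m) λ ls′ → prodLinear ls ≈ X- c * prodLinear ls′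
prodLinear-root (μ ∷ ls) c root
  with ℤ.i*j≡0⇒i≡0∨j≡0 (eval (X- μ) c) (trans (sym (eval-* (X- μ) (prodLinear ls) c)) root)
... | inj₁ cμ≡0 = ls , ≡⇒≈ (cong (λ x → X- x * prodLinear ls) μ≡c)
  where
  μ≡c : μ ≡ c
  μ≡c = sym (ℤ.i-j≡0⇒i≡j c μ (trans (sym (eval-X- μ c)) cμ≡0))
prodLinear-root (μ ∷ [])     c root | inj₂ one≡0 = ⊥-elim (1≢0 (trans (sym (eval-one c)) one≡0))
  where
  1≢0 : + 1 ≢ + 0
  1≢0 ()
prodLinear-root (μ ∷ ν ∷ ls) c root | inj₂ rest≡0 with prodLinear-root (ν ∷ ls) c rest≡0
... | ls′ , rest≈ = μ ∷ ls′ , ≈-trans (*-congˡ (X- μ) rest≈) (swap (X- μ) (X- c) (prodLinear ls′))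
  where
  swap : ∀ a b c → a * (b * c) ≈ b * (a * c)
  swap = solve-∀ Poly-ring

-- Degrees and splitting into linear factors

record Deg≤ (p : Poly) (d : ℕ) : Set where
  constructor deg≤
  field vanishes : ∀ k → d < k → coeff p k ≡ + 0
open Deg≤

record Monic (p : Poly) (d : ℕ) : Set where
  constructor monic
  field
    bounded : Deg≤ p d
    leading : coeff p d ≡ + 1
open Monic

Deg≤-cong : ∀ {p q d} → p ≈ q → Deg≤ p d → Deg≤ q d
Deg≤-cong p≈q (deg≤ p≤d) = deg≤ λ k d<k → trans (sym (coeff-≡ p≈q k)) (p≤d k d<k)

Monic-cong : ∀ {p q d} → p ≈ q → Monic p d → Monic q d
Monic-cong {d = d} p≈q (monic p≤d top) = monic (Deg≤-cong p≈q p≤d) (trans (sym (coeff-≡ p≈q d)) top)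

Deg≤-mono : ∀ {p d e} → d ≤ e → Deg≤ p d → Deg≤ p e
Deg≤-mono d≤e (deg≤ p≤d) = deg≤ λ k e<k → p≤d k (ℕ.<-≤-trans (s≤s d≤e) e<k)

Deg≤-+ : ∀ {p q d} → Deg≤ p d → Deg≤ q d → Deg≤ (p + q) d
Deg≤-+ {p} {q} (deg≤ p≤d) (deg≤ q≤d) =
  deg≤ λ k d<k → trans (coeff-+ p q k) (cong₂ ℤ._+_ (p≤d k d<k) (q≤d k d<k))

Deg≤-neg : ∀ {p d} → Deg≤ p d → Deg≤ (negₚ p) d
Deg≤-neg {p} (deg≤ p≤d) = deg≤ λ k d<k → trans (coeff-neg p k) (cong -_ (p≤d k d<k))

Deg≤-const : ∀ c → Deg≤ (constₚ c) 0
Deg≤-const c = deg≤ λ { (suc k) _ → refl }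

Monic-∷ : ∀ {a p d} → Monic p d → Monic (a ∷ p) (suc d)
Monic-∷ (monic (deg≤ p≤d) top) = monic (deg≤ λ { (suc k) (s≤s d<k) → p≤d k d<k }) top

Monic-∷⁻ : ∀ {a p d} → Monic (a ∷ p) (suc d) → Monic p d
Monic-∷⁻ (monic (deg≤ p≤d) top) = monic (deg≤ λ k d<k → p≤d (suc k) (s≤s d<k)) top

Monic-0 : ∀ {p} → Monic p 0 → p ≈ 1ₚ
Monic-0 (monic (deg≤ p≤0) top) = mk≈ λ { zero → top ; (suc k) → p≤0 (suc k) (s≤s z≤n) }

Monic-0-no-root : ∀ {p} c → Monic p 0 → eval p c ≢ + 0
Monic-0-no-root c p-monic pc≡0 with trans (sym (trans (eval-cong c (Monic-0 p-monic)) (eval-one c))) pc≡0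
... | ()

quotient-zero : ∀ {p} c → p ≈ [] → quotient p c ≈ []
quotient-zero {[]}    c p≈0 = ≈-refl
quotient-zero {a ∷ p} c p≈0 =
  ≈-trans (∷-cong (eval-zero c (tail-zero p≈0)) (quotient-zero c (tail-zero p≈0))) const-zero

quotient-Monic : ∀ p d c → Monic p (suc d) → Monic (quotient p c) d
quotient-Monic []          d       c (monic _ ())
quotient-Monic (a ∷ p)     (suc d) c p-monic = Monic-∷ (quotient-Monic p d c (Monic-∷⁻ p-monic))
quotient-Monic (a ∷ [])    zero    c (monic _ ())
quotient-Monic (a ∷ b ∷ p) zero    c (monic (deg≤ p≤1) top) =
  monic (deg≤ λ { (suc k) _ → coeff-≡ tail≈0 k })
        (trans (cong₂ (λ x y → x ℤ.+ c ℤ.* y) top (eval-zero c p≈0)) (cong (ℤ._+_ (+ 1)) (ℤ.*-zeroʳ c)))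
  where
  p≈0 : p ≈ []
  p≈0 = mk≈ λ k → p≤1 (suc (suc k)) (s≤s (s≤s z≤n))
  tail≈0 : (eval p c ∷ quotient p c) ≈ []
  tail≈0 = ≈-trans (∷-cong (eval-zero c p≈0) (quotient-zero c p≈0)) const-zero

Deg≤-*-leading : ∀ p q d e → Deg≤ p d → Deg≤ q e →
                 Deg≤ (p * q) (d ℕ.+ e) × coeff (p * q) (d ℕ.+ e) ≡ coeff p d ℤ.* coeff q e
Deg≤-*-leading []      q d e _ _ = deg≤ (λ _ _ → refl) , sym (ℤ.*-zeroˡ (coeff q e))
Deg≤-*-leading (a ∷ p) q zero e (deg≤ p≤0) (deg≤ q≤e) = deg≤ a*q≤e , top
  where
  rest≈0 : (+ 0 ∷ p * q) ≈ []
  rest≈0 = 0∷-zero (zero-* q (mk≈ {p} λ k → p≤0 (suc k) (s≤s z≤n)))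
  a*q≤e : ∀ k → e < k → coeff ((a ∷ p) * q) k ≡ + 0
  a*q≤e k e<k = trans (coeff-+ (scaleₚ a q) _ k)
    (cong₂ ℤ._+_ (trans (coeff-scale a q k) (trans (cong (a ℤ.*_) (q≤e k e<k)) (ℤ.*-zeroʳ a)))
                 (coeff-≡ rest≈0 k))
  top : coeff ((a ∷ p) * q) e ≡ a ℤ.* coeff q e
  top = trans (coeff-+ (scaleₚ a q) _ e)
              (trans (cong₂ ℤ._+_ (coeff-scale a q e) (coeff-≡ rest≈0 e)) (ℤ.+-identityʳ _))
Deg≤-*-leading (a ∷ p) q (suc d) e (deg≤ p≤d) (deg≤ q≤e) = deg≤ ap*q≤ , top
  where
  ih = Deg≤-*-leading p q d e (deg≤ λ k d<k → p≤d (suc k) (s≤s d<k)) (deg≤ q≤e)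
  a*q-vanishes : ∀ k → e ≤ k → coeff (scaleₚ a q) (suc k) ≡ + 0
  a*q-vanishes k e≤k = trans (coeff-scale a q (suc k))
                             (trans (cong (a ℤ.*_) (q≤e (suc k) (s≤s e≤k))) (ℤ.*-zeroʳ a))
  ap*q≤ : ∀ k → suc d ℕ.+ e < k → coeff ((a ∷ p) * q) k ≡ + 0
  ap*q≤ (suc k) (s≤s d+e<k) = trans (coeff-+ (scaleₚ a q) _ (suc k))
    (cong₂ ℤ._+_ (a*q-vanishes k (ℕ.≤-trans (ℕ.m≤n+m e d) (ℕ.<⇒≤ d+e<k))) (vanishes (proj₁ ih) k d+e<k))
  top : coeff ((a ∷ p) * q) (suc d ℕ.+ e) ≡ coeff p d ℤ.* coeff q e
  top = trans (coeff-+ (scaleₚ a q) _ (suc (d ℕ.+ e)))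
              (trans (cong₂ ℤ._+_ (a*q-vanishes (d ℕ.+ e) (ℕ.m≤n+m e d)) (proj₂ ih)) (ℤ.+-identityˡ _))

Deg≤-* : ∀ {p q d e} → Deg≤ p d → Deg≤ q e → Deg≤ (p * q) (d ℕ.+ e)
Deg≤-* {p} {q} {d} {e} p≤d q≤e = proj₁ (Deg≤-*-leading p q d e p≤d q≤e)

Monic-* : ∀ {p q d e} → Monic p d → Monic q e → Monic (p * q) (d ℕ.+ e)
Monic-* {p} {q} {d} {e} (monic p≤d p-top) (monic q≤e q-top) =
  let p*q≤ , top = Deg≤-*-leading p q d e p≤d q≤e in
  monic p*q≤ (trans top (cong₂ ℤ._*_ p-top q-top))

Monic-X- : ∀ c → Monic (X- c) 1
Monic-X- c = monic (deg≤ λ { (suc zero) (s≤s ()) ; (suc (suc k)) _ → refl }) refl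

Splits : ℕ → Poly → Set
Splits n p = ∃ λ (ls : Vec ℤ n) → p ≈ prodLinear ls

Splits-cong : ∀ {n p q} → p ≈ q → Splits n p → Splits n q
Splits-cong p≈q (ls , p≈ls) = ls , ≈-trans (≈-sym p≈q) p≈ls

Splits-* : ∀ {m n p q} → Splits m p → Splits n q → Splits (m ℕ.+ n) (p * q)
Splits-* (xs , p≈xs) (ys , q≈ys) = xs ++ ys , ≈-trans (*-cong p≈xs q≈ys) (≈-sym (prodLinear-++ xs ys))

Splits-X- : ∀ c → Splits 1 (X- c)
Splits-X- c = c ∷ [] , ≈-sym (*-identityʳ (X- c))

Splits-∘X- : ∀ {n p} a → Splits n p → Splits n (p ∘ₚ X- a)
Splits-∘X- a (ls , p≈ls) = Vec.map (ℤ._+ a) ls , ≈-trans (∘-congʳ (X- a) p≈ls) (prodLinear-∘-X- ls a)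

Splits-∘X-⇔ : ∀ {n} p a → Splits n (p ∘ₚ X- a) ⇔ Splits n p
Splits-∘X-⇔ p a = mk⇔ (λ p∘ → Splits-cong (∘X-inverse p a) (Splits-∘X- (- a) p∘)) (Splits-∘X- a)

Splits-cancelˡ : ∀ {n} c p → Splits (suc n) (X- c * p) → Splits n p
Splits-cancelˡ c p (ls , cp≈ls) =
  let ls′ , ls≈ = prodLinear-root ls c c-root in
  ls′ , *-cancelˡ-X- c p (prodLinear ls′) (≈-trans cp≈ls ls≈)
  where
  c-root : eval (prodLinear ls) c ≡ + 0
  c-root = trans (sym (eval-cong c cp≈ls))
                 (trans (eval-* (X- c) p c) (cong (ℤ._* eval p c) (eval-X-self c)))

eval-factors-at-root : ∀ {m} μ (ls : Vec ℤ m) A B → A * B ≈ prodLinear (μ ∷ ls) →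
                       eval A μ ℤ.* eval B μ ≡ + 0
eval-factors-at-root μ ls A B AB≈ =
  trans (sym (eval-* A B μ))
        (trans (eval-cong μ AB≈)
               (trans (eval-* (X- μ) (prodLinear ls) μ) (cong (ℤ._* eval (prodLinear ls) μ) (eval-X-self μ))))

-- Peel off the roots μ of the product one at a time: each is a root of A or of B,
-- and the factor theorem moves X - μ out of that factor.
Splits-monicFactor : ∀ {m d e A B} → d ℕ.+ e ≡ m → Monic A d → Monic B e → Splits m (A * B) → Splits d A
Splits-monicFactor {d = zero}  _  A-monic _ ([] , _) = [] , Monic-0 A-monic
Splits-monicFactor {d = suc d} () _ _ ([] , _)
Splits-monicFactor {A = A} {B} d+e≡ A-monic B-monic (μ ∷ ls , AB≈)
  with ℤ.i*j≡0⇒i≡0∨j≡0 (eval A μ) (eval-factors-at-root μ ls A B AB≈)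
Splits-monicFactor {d = zero}  _ A-monic _ (μ ∷ ls , _) | inj₁ Aμ≡0 =
  ⊥-elim (Monic-0-no-root μ A-monic Aμ≡0)
Splits-monicFactor {d = suc d} {A = A} {B} d+e≡ A-monic B-monic (μ ∷ ls , AB≈) | inj₁ Aμ≡0 =
  let ls′ , Q≈ls′ = Splits-monicFactor (ℕ.suc-injective d+e≡) (quotient-Monic A d μ A-monic) B-monic
                                       (ls , QB≈ls)
  in μ ∷ ls′ , ≈-trans A≈ (*-congˡ (X- μ) Q≈ls′)
  where
  A≈ : A ≈ X- μ * quotient A μ
  A≈ = factor-theorem A μ Aμ≡0
  QB≈ls : quotient A μ * B ≈ prodLinear ls
  QB≈ls = *-cancelˡ-X- μ _ _
    (≈-trans (≈-sym (*-assoc (X- μ) (quotient A μ) B)) (≈-trans (*-congʳ B (≈-sym A≈)) AB≈))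
Splits-monicFactor {e = zero}  _ _ B-monic (μ ∷ ls , _) | inj₂ Bμ≡0 =
  ⊥-elim (Monic-0-no-root μ B-monic Bμ≡0)
Splits-monicFactor {d = d} {suc e} {A} {B} d+e≡ A-monic B-monic (μ ∷ ls , AB≈) | inj₂ Bμ≡0 =
  Splits-monicFactor (ℕ.suc-injective (trans (sym (ℕ.+-suc d e)) d+e≡)) A-monic (quotient-Monic B e μ B-monic)
                     (ls , AQ≈ls)
  where
  B≈ : B ≈ X- μ * quotient B μ
  B≈ = factor-theorem B μ Bμ≡0
  swap : ∀ a b c → a * (b * c) ≈ b * (a * c)
  swap = solve-∀ Poly-ring
  AQ≈ls : A * quotient B μ ≈ prodLinear ls
  AQ≈ls = *-cancelˡ-X- μ _ _
    (≈-trans (swap (X- μ) A (quotient B μ)) (≈-trans (*-congˡ A (≈-sym B≈)) AB≈))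

module _ {m₁ m₂ : ℕ} {C P₁ P₂ R₁ R₂ : Poly} (s₀ s t₁ t₂ : ℤ)
         (P₁-monic : Monic P₁ (suc m₁)) (P₂-monic : Monic P₂ (suc m₂))
         (P₁≈ : P₁ ≈ X- t₁ * R₁) (P₂≈ : P₂ ≈ X- t₂ * R₂)
         (C≈ : C ≈ X- s₀ * (X- s * (R₁ * R₂))) where

  Splits-twoRoots⇔ : Splits (suc m₁ ℕ.+ suc m₂) C ⇔ (Splits (suc m₁) P₁ × Splits (suc m₂) P₂)
  Splits-twoRoots⇔ = mk⇔ factors product
    where
    product : Splits (suc m₁) P₁ × Splits (suc m₂) P₂ → Splits (suc m₁ ℕ.+ suc m₂) C
    product (P₁-splits , P₂-splits) =
      Splits-cong (≈-sym C≈) (subst (λ k → Splits k (X- s₀ * (X- s * (R₁ * R₂)))) (degrees m₁ m₂)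
        (Splits-* (Splits-X- s₀) (Splits-* (Splits-X- s)
          (Splits-* (Splits-cancelˡ t₁ R₁ (Splits-cong P₁≈ P₁-splits))
                    (Splits-cancelˡ t₂ R₂ (Splits-cong P₂≈ P₂-splits))))))
      where
      degrees : ∀ x y → suc (suc (x ℕ.+ y)) ≡ suc x ℕ.+ suc y
      degrees = solve-∀ ℕ.ring
    -- (X − t₁)(X − t₂) C = P₁ (X − s₀)(X − s) P₂ splits, and P₁ is a monic factor of it.
    factors : Splits (suc m₁ ℕ.+ suc m₂) C → Splits (suc m₁) P₁ × Splits (suc m₂) P₂
    factors C-splits =
      factor-splits {t = t₁} {t₂} (degrees (suc m₁) (suc m₂)) P₁-monic P₂-monic P₁≈ P₂≈ C≈ ,
      factor-splits {t = t₂} {t₁}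
                    (trans (degrees (suc m₂) (suc m₁)) (cong (λ k → ℕ.suc (ℕ.suc k)) (ℕ.+-comm (suc m₂) (suc m₁))))
                    P₂-monic P₁-monic P₂≈ P₁≈ (≈-trans C≈ (*-congˡ (X- s₀) (*-congˡ (X- s) (*-comm R₁ R₂))))
      where
      degrees : ∀ x y → x ℕ.+ suc (suc y) ≡ suc (suc (x ℕ.+ y))
      degrees = solve-∀ ℕ.ring
      rearrange : ∀ s₀ s t t′ r r′ → (t * r) * (s₀ * (s * (t′ * r′))) ≈ t * (t′ * (s₀ * (s * (r * r′))))
      rearrange = solve-∀ Poly-ring
      factor-splits : ∀ {d e P P′ t t′ R R′} → d ℕ.+ suc (suc e) ≡ suc (suc (suc m₁ ℕ.+ suc m₂)) →
                      Monic P d → Monic P′ e → P ≈ X- t * R → P′ ≈ X- t′ * R′ →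
                      C ≈ X- s₀ * (X- s * (R * R′)) → Splits d P
      factor-splits {P = P} {P′} {t} {t′} {R} {R′} degree P-monic P′-monic P≈ P′≈ C≈′ =
        Splits-monicFactor degree P-monic (Monic-* (Monic-X- s₀) (Monic-* (Monic-X- s) P′-monic))
          (Splits-cong product-form (Splits-* (Splits-X- t) (Splits-* (Splits-X- t′) C-splits)))
        where
        product-form : X- t * (X- t′ * C) ≈ P * (X- s₀ * (X- s * P′))
        product-form = ≈-sym (begin
          P * (X- s₀ * (X- s * P′))
            ≈⟨ *-cong P≈ (*-congˡ (X- s₀) (*-congˡ (X- s) P′≈)) ⟩
          (X- t * R) * (X- s₀ * (X- s * (X- t′ * R′)))
            ≈⟨ rearrange (X- s₀) (X- s) (X- t) (X- t′) R R′ ⟩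
          X- t * (X- t′ * (X- s₀ * (X- s * (R * R′))))
            ≈⟨ *-congˡ (X- t) (*-congˡ (X- t′) C≈′) ⟨
          X- t * (X- t′ * C) ∎)

-- Determinants by Laplace expansion

PMat : ℕ → Set
PMat n = Fin n → Fin n → Poly

minor : ∀ {n} → Fin (suc n) → PMat (suc n) → PMat n
minor j M i k = M (suc i) (punchIn j k)

laplaceTerm : ∀ {n} → PMat (suc n) → Fin (suc n) → Poly
laplaceTerm M j = sign (toℕ j) (M zero j * detₚ (minor j M))

sign-cong : ∀ k {p q} → p ≈ q → sign k p ≈ sign k q
sign-cong zero          p≈q = p≈q
sign-cong (suc zero)    p≈q = neg-cong p≈q
sign-cong (suc (suc k)) p≈q = sign-cong k p≈q

sign-+ : ∀ k p q → sign k (p + q) ≈ sign k p + sign k q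
sign-+ zero          p q = ≈-refl
sign-+ (suc zero)    p q = neg-distrib-+ p q
sign-+ (suc (suc k)) p q = sign-+ k p q

sign-*ˡ : ∀ k a p → sign k (a * p) ≈ a * sign k p
sign-*ˡ zero          a p = ≈-refl
sign-*ˡ (suc zero)    a p = neg-distribʳ-* a p
sign-*ˡ (suc (suc k)) a p = sign-*ˡ k a p

sign-zero : ∀ k → sign k [] ≈ []
sign-zero zero          = ≈-refl
sign-zero (suc zero)    = ≈-refl
sign-zero (suc (suc k)) = sign-zero k

sign-suc : ∀ k p → sign (suc k) p ≈ negₚ (sign k p)
sign-suc zero          p = ≈-refl
sign-suc (suc zero)    p = ≈-sym (neg-involutive p)
sign-suc (suc (suc k)) p = sign-suc k p

sumₚ-cong : ∀ {n} {f g : Fin n → Poly} → (∀ j → f j ≈ g j) → sumₚ f ≈ sumₚ g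
sumₚ-cong {zero}  f≈g = ≈-refl
sumₚ-cong {suc n} f≈g = +-cong (f≈g zero) (sumₚ-cong (f≈g ∘ suc))

sumₚ-+ : ∀ {n} (f g : Fin n → Poly) → sumₚ (λ j → f j + g j) ≈ sumₚ f + sumₚ g
sumₚ-+ {zero}  f g = ≈-refl
sumₚ-+ {suc n} f g = ≈-trans (+-congˡ (f zero + g zero) (sumₚ-+ (f ∘ suc) (g ∘ suc)))
                             (+-interchange (f zero) (g zero) _ _)

sumₚ-*ˡ : ∀ {n} a (f : Fin n → Poly) → a * sumₚ f ≈ sumₚ (λ j → a * f j)
sumₚ-*ˡ {zero}  a f = *-zeroʳ a
sumₚ-*ˡ {suc n} a f = ≈-trans (*-distribˡ a (f zero) _) (+-congˡ (a * f zero) (sumₚ-*ˡ a (f ∘ suc)))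

sumₚ-*ʳ : ∀ {n} (f : Fin n → Poly) a → sumₚ f * a ≈ sumₚ (λ j → f j * a)
sumₚ-*ʳ f a = ≈-trans (*-comm (sumₚ f) a) (≈-trans (sumₚ-*ˡ a f) (sumₚ-cong λ j → *-comm a (f j)))

sumₚ-neg : ∀ {n} (f : Fin n → Poly) → sumₚ (λ j → negₚ (f j)) ≈ negₚ (sumₚ f)
sumₚ-neg {zero}  f = ≈-refl
sumₚ-neg {suc n} f = ≈-trans (+-congˡ (negₚ (f zero)) (sumₚ-neg (f ∘ suc)))
                             (≈-sym (neg-distrib-+ (f zero) (sumₚ (f ∘ suc))))

sumₚ-const : ∀ {n} (f : Fin n → ℤ) → sumₚ (λ j → constₚ (f j)) ≈ constₚ (sumZ f)
sumₚ-const {zero}  f = ≈-sym const-zero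
sumₚ-const {suc n} f = +-congˡ (constₚ (f zero)) (sumₚ-const (f ∘ suc))

sumₚ-replicate : ∀ {n} c → sumₚ {n} (λ _ → constₚ c) ≈ constₚ (+ n ℤ.* c)
sumₚ-replicate {zero}  c = ≈-sym const-zero
sumₚ-replicate {suc n} c =
  ≈-trans (+-congˡ (constₚ c) (sumₚ-replicate {n} c)) (≡⇒≈ (cong constₚ (distrib (+ n) c)))
  where
  distrib : ∀ x c → c ℤ.+ x ℤ.* c ≡ (+ 1 ℤ.+ x) ℤ.* c
  distrib = solve-∀ ℤ.ring

sumₚ-+const : ∀ {n} (f : Fin n → Poly) c → sumₚ (λ j → f j + constₚ c) ≈ sumₚ f + constₚ (+ n ℤ.* c)
sumₚ-+const {n} f c = ≈-trans (sumₚ-+ f (λ _ → constₚ c)) (+-congˡ (sumₚ f) (sumₚ-replicate {n} c))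

sumₚ-zero : ∀ {n} (f : Fin n → Poly) → (∀ j → f j ≈ []) → sumₚ f ≈ []
sumₚ-zero {zero}  f f≈0 = ≈-refl
sumₚ-zero {suc n} f f≈0 = +-cong (f≈0 zero) (sumₚ-zero (f ∘ suc) (f≈0 ∘ suc))

sumₚ-single : ∀ {n} (f : Fin n → Poly) i → (∀ j → j ≢ i → f j ≈ []) → sumₚ f ≈ f i
sumₚ-single {suc n} f zero    f≈0 =
  ≈-trans (+-congˡ (f zero) (sumₚ-zero (f ∘ suc) λ j → f≈0 (suc j) λ ())) (+-identityʳ _)
sumₚ-single {suc n} f (suc i) f≈0 =
  +-cong (f≈0 zero λ ()) (sumₚ-single (f ∘ suc) i λ j j≢i → f≈0 (suc j) (j≢i ∘ Fin.suc-injective))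

sumₚ-↑ : ∀ m {n} (f : Fin (m ℕ.+ n) → Poly) →
         sumₚ f ≈ sumₚ (λ i → f (i ↑ˡ n)) + sumₚ (λ j → f (m ↑ʳ j))
sumₚ-↑ zero    f = ≈-refl
sumₚ-↑ (suc m) f = ≈-trans (+-congˡ (f zero) (sumₚ-↑ m (f ∘ suc))) (≈-sym (+-assoc (f zero) _ _))

δ-refl : ∀ {n} (i : Fin n) → δ i i ≡ true
δ-refl i with i Fin.≟ i
... | yes _  = refl
... | no i≢i = ⊥-elim (i≢i refl)

δ-≢ : ∀ {n} {i j : Fin n} → i ≢ j → δ i j ≡ false
δ-≢ {i = i} {j} i≢j with i Fin.≟ j
... | yes i≡j = ⊥-elim (i≢j i≡j)
... | no _    = refl

sumₚ-δ : ∀ {n} i (p : Poly) → sumₚ {n} (λ j → if δ i j then p else []) ≈ p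
sumₚ-δ i p = ≈-trans (sumₚ-single _ i λ j j≢i → ≡⇒≈ (cong (λ b → if b then p else []) (δ-≢ (j≢i ∘ sym))))
                     (≡⇒≈ (cong (λ b → if b then p else []) (δ-refl i)))

sumₚ-extract : ∀ {n} (f : Fin n → Poly) i → sumₚ f ≈ f i + sumₚ (λ j → if δ i j then [] else f j)
sumₚ-extract f i = begin
  sumₚ f                                                                  ≈⟨ sumₚ-cong split ⟩
  sumₚ (λ j → (if δ i j then f i else []) + (if δ i j then [] else f j))
    ≈⟨ sumₚ-+ (λ j → if δ i j then f i else []) (λ j → if δ i j then [] else f j) ⟩
  sumₚ (λ j → if δ i j then f i else []) + sumₚ (λ j → if δ i j then [] else f j)
    ≈⟨ +-congʳ (sumₚ (λ j → if δ i j then [] else f j)) (sumₚ-δ i (f i)) ⟩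
  f i + sumₚ (λ j → if δ i j then [] else f j) ∎
  where
  split : ∀ j → f j ≈ (if δ i j then f i else []) + (if δ i j then [] else f j)
  split j with i Fin.≟ j
  ... | yes refl = ≈-sym (+-identityʳ (f i))
  ... | no _     = ≈-refl

≈-from-rowSums : ∀ {n} (A B : PMat n) → (∀ i → sumₚ (A i) ≈ sumₚ (B i)) →
                 (∀ i j → i ≢ j → A i j ≈ B i j) → ∀ i j → A i j ≈ B i j
≈-from-rowSums A B rowSums off i j with i Fin.≟ j
... | no i≢j   = off i j i≢j
... | yes refl = begin
  A i i
    ≈⟨ cancel (A i i) (rest A) ⟨
  (A i i + rest A) + negₚ (rest A)
    ≈⟨ +-cong (≈-trans (≈-sym (sumₚ-extract (A i) i)) (≈-trans (rowSums i) (sumₚ-extract (B i) i)))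
              (neg-cong rest≈) ⟩
  (B i i + rest B) + negₚ (rest B)
    ≈⟨ cancel (B i i) (rest B) ⟩
  B i i ∎
  where
  rest : PMat _ → Poly
  rest C = sumₚ (λ j → if δ i j then [] else C i j)
  rest≈ : rest A ≈ rest B
  rest≈ = sumₚ-cong off-diagonal
    where
    off-diagonal : ∀ j → (if δ i j then [] else A i j) ≈ (if δ i j then [] else B i j)
    off-diagonal j with i Fin.≟ j
    ... | yes _   = ≈-refl
    ... | no i≢j  = off i j i≢j
  cancel : ∀ p q → (p + q) + negₚ q ≈ p
  cancel = solve-∀ Poly-ring

sumₚ-pair : ∀ {n} (f : Fin n → Poly) a b → a ≢ b → (∀ j → j ≢ a → j ≢ b → f j ≈ []) →
            sumₚ f ≈ f a + f b
sumₚ-pair f a b a≢b f≈0 = begin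
  sumₚ f                                          ≈⟨ sumₚ-extract f a ⟩
  f a + sumₚ (λ j → if δ a j then [] else f j)    ≈⟨ +-congˡ (f a) (sumₚ-single _ b others) ⟩
  f a + (if δ a b then [] else f b)               ≡⟨ cong (λ t → f a + (if t then [] else f b)) (δ-≢ a≢b) ⟩
  f a + f b                                       ∎
  where
  others : ∀ j → j ≢ b → (if δ a j then [] else f j) ≈ []
  others j j≢b with a Fin.≟ j
  ... | yes _   = ≈-refl
  ... | no a≢j  = f≈0 j (a≢j ∘ sym) j≢b

det-cong : ∀ {n} {M N : PMat n} → (∀ i j → M i j ≈ N i j) → detₚ M ≈ detₚ N
det-cong {zero}  M≈N = ≈-refl
det-cong {suc n} M≈N =
  sumₚ-cong λ j → sign-cong (toℕ j) (*-cong (M≈N zero j) (det-cong λ i k → M≈N (suc i) (punchIn j k)))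

AgreeOff : ∀ {n} → Fin n → PMat n → PMat n → Set
AgreeOff c A B = ∀ i j → j ≢ c → A i j ≈ B i j

punchIn-≢ : ∀ {n} (j : Fin (suc n)) {c} (j≢c : j ≢ c) k → k ≢ punchOut j≢c → punchIn j k ≢ c
punchIn-≢ j j≢c k k≢ pj≡c =
  k≢ (Fin.punchIn-injective j k (punchOut j≢c) (trans pj≡c (sym (Fin.punchIn-punchOut j≢c))))

AgreeOff-minor : ∀ {n} {c : Fin (suc n)} {A B} → AgreeOff c A B →
                 ∀ j (j≢c : j ≢ c) → AgreeOff (punchOut j≢c) (minor j A) (minor j B)
AgreeOff-minor A≈B j j≢c i k k≢ = A≈B (suc i) (punchIn j k) (punchIn-≢ j j≢c k k≢)

minor-punchOut : ∀ {n} {c : Fin (suc n)} (A : PMat (suc n)) j (j≢c : j ≢ c) i →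
                 minor j A i (punchOut j≢c) ≡ A (suc i) c
minor-punchOut A j j≢c i = cong (A (suc i)) (Fin.punchIn-punchOut j≢c)

minor-AgreeOff : ∀ {n} {c : Fin (suc n)} {A B} → AgreeOff c A B → ∀ i k → minor c A i k ≈ minor c B i k
minor-AgreeOff {c = c} A≈B i k = A≈B (suc i) (punchIn c k) (Fin.punchInᵢ≢i c k)

det-linear-+ : ∀ {n} c (A B C : PMat n) → AgreeOff c A B → AgreeOff c A C →
               (∀ i → A i c ≈ B i c + C i c) → detₚ A ≈ detₚ B + detₚ C
det-linear-+ {suc n} c A B C A≈B A≈C col = ≈-trans (sumₚ-cong term) (sumₚ-+ (laplaceTerm B) (laplaceTerm C))
  where
  term : ∀ j → laplaceTerm A j ≈ laplaceTerm B j + laplaceTerm C j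
  term j with j Fin.≟ c
  ... | yes refl = begin
    sign (toℕ j) (A zero j * detₚ (minor j A))
      ≈⟨ sign-cong (toℕ j) (*-congʳ (detₚ (minor j A)) (col zero)) ⟩
    sign (toℕ j) ((B zero j + C zero j) * detₚ (minor j A))
      ≈⟨ sign-cong (toℕ j) (*-distribʳ (B zero j) (C zero j) (detₚ (minor j A))) ⟩
    sign (toℕ j) (B zero j * detₚ (minor j A) + C zero j * detₚ (minor j A))
      ≈⟨ sign-+ (toℕ j) _ _ ⟩
    sign (toℕ j) (B zero j * detₚ (minor j A)) + sign (toℕ j) (C zero j * detₚ (minor j A))
      ≈⟨ +-cong (sign-cong (toℕ j) (*-congˡ (B zero j) (det-cong (minor-AgreeOff A≈B))))
                (sign-cong (toℕ j) (*-congˡ (C zero j) (det-cong (minor-AgreeOff A≈C)))) ⟩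
    laplaceTerm B j + laplaceTerm C j ∎
  ... | no j≢c = begin
    sign (toℕ j) (A zero j * detₚ (minor j A))
      ≈⟨ sign-cong (toℕ j) (*-congˡ (A zero j) minor-linear) ⟩
    sign (toℕ j) (A zero j * (detₚ (minor j B) + detₚ (minor j C)))
      ≈⟨ sign-cong (toℕ j) (*-distribˡ (A zero j) (detₚ (minor j B)) (detₚ (minor j C))) ⟩
    sign (toℕ j) (A zero j * detₚ (minor j B) + A zero j * detₚ (minor j C))
      ≈⟨ sign-+ (toℕ j) _ _ ⟩
    sign (toℕ j) (A zero j * detₚ (minor j B)) + sign (toℕ j) (A zero j * detₚ (minor j C))
      ≈⟨ +-cong (sign-cong (toℕ j) (*-congʳ (detₚ (minor j B)) (A≈B zero j j≢c)))
                (sign-cong (toℕ j) (*-congʳ (detₚ (minor j C)) (A≈C zero j j≢c))) ⟩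
    laplaceTerm B j + laplaceTerm C j ∎
    where
    minor-col : ∀ i → minor j A i (punchOut j≢c) ≈ minor j B i (punchOut j≢c) + minor j C i (punchOut j≢c)
    minor-col i rewrite minor-punchOut A j j≢c i | minor-punchOut B j j≢c i | minor-punchOut C j j≢c i = col (suc i)
    minor-linear : detₚ (minor j A) ≈ detₚ (minor j B) + detₚ (minor j C)
    minor-linear = det-linear-+ (punchOut j≢c) (minor j A) (minor j B) (minor j C)
                     (AgreeOff-minor A≈B j j≢c) (AgreeOff-minor A≈C j j≢c) minor-col

det-linear-* : ∀ {n} c α (A B : PMat n) → AgreeOff c A B → (∀ i → A i c ≈ α * B i c) →
               detₚ A ≈ α * detₚ B
det-linear-* {suc n} c α A B A≈B col = ≈-trans (sumₚ-cong term) (≈-sym (sumₚ-*ˡ α (laplaceTerm B)))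
  where
  assoc : ∀ a b d → (a * b) * d ≈ a * (b * d)
  assoc = solve-∀ Poly-ring
  swap : ∀ a b d → a * (b * d) ≈ b * (a * d)
  swap = solve-∀ Poly-ring
  term : ∀ j → laplaceTerm A j ≈ α * laplaceTerm B j
  term j with j Fin.≟ c
  ... | yes refl = begin
    sign (toℕ j) (A zero j * detₚ (minor j A))
      ≈⟨ sign-cong (toℕ j) (*-cong (col zero) (det-cong (minor-AgreeOff A≈B))) ⟩
    sign (toℕ j) ((α * B zero j) * detₚ (minor j B))
      ≈⟨ sign-cong (toℕ j) (assoc α (B zero j) (detₚ (minor j B))) ⟩
    sign (toℕ j) (α * (B zero j * detₚ (minor j B)))
      ≈⟨ sign-*ˡ (toℕ j) α _ ⟩
    α * laplaceTerm B j ∎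
  ... | no j≢c = begin
    sign (toℕ j) (A zero j * detₚ (minor j A))
      ≈⟨ sign-cong (toℕ j) (*-cong (A≈B zero j j≢c) minor-linear) ⟩
    sign (toℕ j) (B zero j * (α * detₚ (minor j B)))
      ≈⟨ sign-cong (toℕ j) (swap (B zero j) α (detₚ (minor j B))) ⟩
    sign (toℕ j) (α * (B zero j * detₚ (minor j B)))
      ≈⟨ sign-*ˡ (toℕ j) α _ ⟩
    α * laplaceTerm B j ∎
    where
    minor-col : ∀ i → minor j A i (punchOut j≢c) ≈ α * minor j B i (punchOut j≢c)
    minor-col i rewrite minor-punchOut A j j≢c i | minor-punchOut B j j≢c i = col (suc i)
    minor-linear : detₚ (minor j A) ≈ α * detₚ (minor j B)
    minor-linear = det-linear-* (punchOut j≢c) α (minor j A) (minor j B) (AgreeOff-minor A≈B j j≢c) minor-col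

setColumn : ∀ {n} → PMat n → Fin n → (Fin n → Poly) → PMat n
setColumn M c u i j = if δ j c then u i else M i j

setColumn-≡ : ∀ {n} (M : PMat n) c u i → setColumn M c u i c ≡ u i
setColumn-≡ M c u i rewrite δ-refl c = refl

setColumn-≢ : ∀ {n} (M : PMat n) {c} u i {j} → j ≢ c → setColumn M c u i j ≡ M i j
setColumn-≢ M u i j≢c rewrite δ-≢ j≢c = refl

AgreeOff-setColumn : ∀ {n} (M : PMat n) c u v → AgreeOff c (setColumn M c u) (setColumn M c v)
AgreeOff-setColumn M c u v i j j≢c = ≡⇒≈ (trans (setColumn-≢ M u i j≢c) (sym (setColumn-≢ M v i j≢c)))

AgreeOff-setColumnʳ : ∀ {n} {A M : PMat n} {c} u → AgreeOff c A M → AgreeOff c A (setColumn M c u)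
AgreeOff-setColumnʳ {M = M} u A≈M i j j≢c = ≈-trans (A≈M i j j≢c) (≡⇒≈ (sym (setColumn-≢ M u i j≢c)))

setColumn-self : ∀ {n} (M : PMat n) c i j → setColumn M c (λ i → M i c) i j ≡ M i j
setColumn-self M c i j with j Fin.≟ c
... | yes refl = refl
... | no _     = refl

toℕ-punchIn : ∀ {n} (j : Fin (suc n)) (k : Fin n) →
              (toℕ k < toℕ j × toℕ (punchIn j k) ≡ toℕ k) ⊎
              (toℕ j ≤ toℕ k × toℕ (punchIn j k) ≡ suc (toℕ k))
toℕ-punchIn zero    k       = inj₂ (z≤n , refl)
toℕ-punchIn (suc j) zero    = inj₁ (s≤s z≤n , refl)
toℕ-punchIn (suc j) (suc k) with toℕ-punchIn j k
... | inj₁ (k<j , eq) = inj₁ (s≤s k<j , cong suc eq)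
... | inj₂ (j≤k , eq) = inj₂ (s≤s j≤k , cong suc eq)

punchOut-adjacent : ∀ {n} (j a b : Fin (suc n)) (j≢a : j ≢ a) (j≢b : j ≢ b) → toℕ b ≡ suc (toℕ a) →
                    toℕ (punchOut j≢b) ≡ suc (toℕ (punchOut j≢a))
punchOut-adjacent j a b j≢a j≢b b≡1+a
  with toℕ-punchIn j (punchOut j≢a) | toℕ-punchIn j (punchOut j≢b)
... | inj₁ (_ , ea) | inj₁ (_ , eb) = trans (sym eb) (trans (on-b) (cong suc (trans (sym on-a) ea)))
  where
  on-a = cong toℕ (Fin.punchIn-punchOut j≢a)
  on-b = trans (cong toℕ (Fin.punchIn-punchOut j≢b)) b≡1+a
... | inj₂ (_ , ea) | inj₂ (_ , eb) =
  ℕ.suc-injective (trans (sym eb) (trans on-b (cong suc (trans (sym on-a) ea))))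
  where
  on-a = cong toℕ (Fin.punchIn-punchOut j≢a)
  on-b = trans (cong toℕ (Fin.punchIn-punchOut j≢b)) b≡1+a
... | inj₁ (a′<j , ea) | inj₂ (j≤b′ , eb) =
  ⊥-elim (ℕ.<-irrefl refl (ℕ.<-≤-trans a′<j (ℕ.≤-trans j≤b′ (ℕ.≤-reflexive b′≡a′))))
  where
  b′≡a′ : toℕ (punchOut j≢b) ≡ toℕ (punchOut j≢a)
  b′≡a′ = ℕ.suc-injective (trans (sym eb) (trans (trans (cong toℕ (Fin.punchIn-punchOut j≢b)) b≡1+a)
                            (cong suc (trans (sym (cong toℕ (Fin.punchIn-punchOut j≢a))) ea))))
... | inj₂ (j≤a′ , ea) | inj₁ (b′<j , eb) =
  ⊥-elim (ℕ.<-irrefl refl (ℕ.<-≤-trans b′<j (ℕ.≤-trans j≤a′ a′≤b′)))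
  where
  b′≡ : toℕ (punchOut j≢b) ≡ suc (suc (toℕ (punchOut j≢a)))
  b′≡ = trans (sym eb) (trans (trans (cong toℕ (Fin.punchIn-punchOut j≢b)) b≡1+a)
                              (cong suc (trans (sym (cong toℕ (Fin.punchIn-punchOut j≢a))) ea)))
  a′≤b′ : toℕ (punchOut j≢a) ≤ toℕ (punchOut j≢b)
  a′≤b′ = ℕ.≤-trans (ℕ.n≤1+n _) (ℕ.≤-trans (ℕ.n≤1+n _) (ℕ.≤-reflexive (sym b′≡)))

punchIn-adjacent : ∀ {n} (a b : Fin (suc n)) → toℕ b ≡ suc (toℕ a) → ∀ k →
                   (punchIn a k ≡ punchIn b k) ⊎ (punchIn a k ≡ b × punchIn b k ≡ a)
punchIn-adjacent a b b≡1+a k with toℕ-punchIn a k | toℕ-punchIn b k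
... | inj₁ (_ , ea) | inj₁ (_ , eb) = inj₁ (Fin.toℕ-injective (trans ea (sym eb)))
... | inj₂ (_ , ea) | inj₂ (_ , eb) = inj₁ (Fin.toℕ-injective (trans ea (sym eb)))
... | inj₁ (k<a , _) | inj₂ (b≤k , _) =
  ⊥-elim (ℕ.<-irrefl refl (ℕ.<-≤-trans k<a (ℕ.≤-trans (ℕ.n≤1+n _) (ℕ.≤-trans (ℕ.≤-reflexive (sym b≡1+a)) b≤k))))
... | inj₂ (a≤k , ea) | inj₁ (k<b , eb) =
  inj₂ (Fin.toℕ-injective (trans ea (trans (cong suc k≡a) (sym b≡1+a))) , Fin.toℕ-injective (trans eb k≡a))
  where
  k≡a : toℕ k ≡ toℕ a
  k≡a = ℕ.≤-antisym (ℕ.≤-pred (ℕ.≤-trans k<b (ℕ.≤-reflexive b≡1+a))) a≤k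

adjacent⇒≢ : ∀ {n} {a b : Fin n} → toℕ b ≡ suc (toℕ a) → a ≢ b
adjacent⇒≢ {a = a} b≡1+a a≡b = ℕ.<-irrefl (trans (cong toℕ a≡b) b≡1+a) (ℕ.n<1+n (toℕ a))

-- The two Laplace terms at the equal columns cancel, because their minors coincide
-- and their signs differ; all other minors again have two adjacent equal columns.
det-adjacentEqualColumns : ∀ {n} (M : PMat n) a b → toℕ b ≡ suc (toℕ a) → (∀ i → M i a ≈ M i b) →
                           detₚ M ≈ []
det-adjacentEqualColumns {suc n} M a b b≡1+a col =
  ≈-trans (sumₚ-pair (laplaceTerm M) a b (adjacent⇒≢ b≡1+a) others) pair
  where
  others : ∀ j → j ≢ a → j ≢ b → laplaceTerm M j ≈ []
  others j j≢a j≢b =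
    ≈-trans (sign-cong (toℕ j) (≈-trans (*-congˡ (M zero j) minor≈0) (*-zeroʳ (M zero j)))) (sign-zero (toℕ j))
    where
    minor≈0 : detₚ (minor j M) ≈ []
    minor≈0 = det-adjacentEqualColumns (minor j M) (punchOut j≢a) (punchOut j≢b)
      (punchOut-adjacent j a b j≢a j≢b b≡1+a)
      (λ i → subst₂ (λ u v → M (suc i) u ≈ M (suc i) v)
                    (sym (Fin.punchIn-punchOut j≢a)) (sym (Fin.punchIn-punchOut j≢b)) (col (suc i)))
  minors≈ : ∀ i k → minor b M i k ≈ minor a M i k
  minors≈ i k with punchIn-adjacent a b b≡1+a k
  ... | inj₁ eq         = ≡⇒≈ (cong (M (suc i)) (sym eq))
  ... | inj₂ (ea , eb) = subst₂ (λ u v → M (suc i) u ≈ M (suc i) v) (sym eb) (sym ea) (col (suc i))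
  pair : laplaceTerm M a + laplaceTerm M b ≈ []
  pair = begin
    laplaceTerm M a + laplaceTerm M b
      ≈⟨ +-congˡ (laplaceTerm M a) (sign-cong (toℕ b) (*-cong (≈-sym (col zero)) (det-cong minors≈))) ⟩
    laplaceTerm M a + sign (toℕ b) (M zero a * detₚ (minor a M))
      ≡⟨ cong (λ t → laplaceTerm M a + sign t (M zero a * detₚ (minor a M))) b≡1+a ⟩
    laplaceTerm M a + sign (suc (toℕ a)) (M zero a * detₚ (minor a M))
      ≈⟨ +-congˡ (laplaceTerm M a) (sign-suc (toℕ a) _) ⟩
    laplaceTerm M a + negₚ (laplaceTerm M a)
      ≈⟨ -‿inverseʳ (laplaceTerm M a) ⟩
    [] ∎

swapColumns : ∀ {n} → PMat n → Fin n → Fin n → PMat n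
swapColumns M a b = setColumn (setColumn M a (λ i → M i b)) b (λ i → M i a)

-- Expand the determinant with both columns a and b equal to (column a + column b)
-- by linearity in each of them.
det-swapAdjacentColumns : ∀ {n} (M : PMat n) a b → toℕ b ≡ suc (toℕ a) →
                          detₚ (swapColumns M a b) ≈ negₚ (detₚ M)
det-swapAdjacentColumns {n} M a b b≡1+a = +≈0⇒≈neg (detₚ M) (detₚ (swapColumns M a b)) (≈-sym total)
  where
  b≢a : b ≢ a
  b≢a = adjacent⇒≢ b≡1+a ∘ sym
  N : (Fin n → Poly) → (Fin n → Poly) → PMat n
  N u v = setColumn (setColumn M a u) b v
  N-a : ∀ u v i → N u v i a ≡ u i
  N-a u v i = trans (setColumn-≢ (setColumn M a u) v i (b≢a ∘ sym)) (setColumn-≡ M a u i)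
  N-b : ∀ u v i → N u v i b ≡ v i
  N-b u v i = setColumn-≡ (setColumn M a u) b v i
  AgreeOff-a : ∀ u u′ v → AgreeOff a (N u v) (N u′ v)
  AgreeOff-a u u′ v i j j≢a with j Fin.≟ b
  ... | yes refl = ≈-refl
  ... | no _     = ≡⇒≈ (trans (setColumn-≢ M u i j≢a) (sym (setColumn-≢ M u′ i j≢a)))
  linear-a : ∀ u u′ v → detₚ (N (λ i → u i + u′ i) v) ≈ detₚ (N u v) + detₚ (N u′ v)
  linear-a u u′ v = det-linear-+ a _ _ _ (AgreeOff-a _ u v) (AgreeOff-a _ u′ v)
    λ i → ≡⇒≈ (trans (N-a (λ i → u i + u′ i) v i) (sym (cong₂ _+_ (N-a u v i) (N-a u′ v i))))
  linear-b : ∀ u v v′ → detₚ (N u (λ i → v i + v′ i)) ≈ detₚ (N u v) + detₚ (N u v′)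
  linear-b u v v′ = det-linear-+ b _ _ _ (AgreeOff-setColumn _ b _ v) (AgreeOff-setColumn _ b _ v′)
    λ i → ≡⇒≈ (trans (N-b u (λ i → v i + v′ i) i) (sym (cong₂ _+_ (N-b u v i) (N-b u v′ i))))
  N-equal : ∀ u → detₚ (N u u) ≈ []
  N-equal u = det-adjacentEqualColumns (N u u) a b b≡1+a λ i → ≡⇒≈ (trans (N-a u u i) (sym (N-b u u i)))
  colA colB : Fin n → Poly
  colA i = M i a
  colB i = M i b
  N≈M : ∀ i j → N colA colB i j ≈ M i j
  N≈M i j with j Fin.≟ b
  ... | yes refl = ≈-refl
  ... | no _     = ≡⇒≈ (setColumn-self M a i j)
  total : [] ≈ detₚ M + detₚ (swapColumns M a b)
  total = begin
    []
      ≈⟨ N-equal (λ i → colA i + colB i) ⟨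
    detₚ (N (λ i → colA i + colB i) (λ i → colA i + colB i))
      ≈⟨ linear-a colA colB _ ⟩
    detₚ (N colA _) + detₚ (N colB _)
      ≈⟨ +-cong (linear-b colA colA colB) (linear-b colB colA colB) ⟩
    (detₚ (N colA colA) + detₚ (N colA colB)) + (detₚ (N colB colA) + detₚ (N colB colB))
      ≈⟨ +-cong (+-cong (N-equal colA) (det-cong N≈M)) (+-cong ≈-refl (N-equal colB)) ⟩
    ([] + detₚ M) + (detₚ (swapColumns M a b) + [])
      ≈⟨ +-congˡ (detₚ M) (+-identityʳ _) ⟩
    detₚ M + detₚ (swapColumns M a b) ∎

swapColumns-≢ : ∀ {n} (M : PMat n) a b i {j} → j ≢ a → j ≢ b → swapColumns M a b i j ≡ M i j
swapColumns-≢ M a b i j≢a j≢b =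
  trans (setColumn-≢ (setColumn M a (λ i → M i b)) (λ i → M i a) i j≢b) (setColumn-≢ M (λ i → M i b) i j≢a)

swapColumns-a : ∀ {n} (M : PMat n) {a b} i → a ≢ b → swapColumns M a b i a ≡ M i b
swapColumns-a M {a} {b} i a≢b =
  trans (setColumn-≢ (setColumn M a (λ i → M i b)) (λ i → M i a) i a≢b) (setColumn-≡ M a (λ i → M i b) i)

-- Induction on the distance d + 1 between the columns: swapping column b with its
-- left neighbour brings the equal columns closer and only changes the sign.
det-equalColumns-at : ∀ d {n} (M : PMat n) a b → toℕ b ≡ suc (d ℕ.+ toℕ a) →
                      (∀ i → M i a ≈ M i b) → detₚ M ≈ []
det-equalColumns-at zero    M a b b≡ col = det-adjacentEqualColumns M a b b≡ col
det-equalColumns-at (suc d) M a (suc b₀) b≡ col = begin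
  detₚ M                           ≈⟨ neg-involutive (detₚ M) ⟨
  negₚ (negₚ (detₚ M))             ≈⟨ neg-cong (det-swapAdjacentColumns M c b b≡1+c) ⟨
  negₚ (detₚ (swapColumns M c b))  ≈⟨ neg-cong swapped≈0 ⟩
  []                               ∎
  where
  b c : Fin _
  b = suc b₀
  c = inject₁ b₀
  c≡ : toℕ c ≡ suc (d ℕ.+ toℕ a)
  c≡ = trans (Fin.toℕ-inject₁ b₀) (ℕ.suc-injective b≡)
  b≡1+c : toℕ b ≡ suc (toℕ c)
  b≡1+c = cong suc (sym (Fin.toℕ-inject₁ b₀))
  a<c : toℕ a < toℕ c
  a<c = subst (toℕ a <_) (sym c≡) (s≤s (ℕ.m≤n+m (toℕ a) d))
  a≢c : a ≢ c
  a≢c a≡c = ℕ.<-irrefl (cong toℕ a≡c) a<c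
  a≢b : a ≢ b
  a≢b a≡b = ℕ.<-irrefl (cong toℕ a≡b) (ℕ.<-trans a<c (subst (toℕ c <_) (sym b≡1+c) (ℕ.n<1+n _)))
  swapped≈0 : detₚ (swapColumns M c b) ≈ []
  swapped≈0 = det-equalColumns-at d (swapColumns M c b) a c c≡ λ i →
    ≈-trans (≡⇒≈ (swapColumns-≢ M c b i a≢c a≢b))
            (≈-trans (col i) (≡⇒≈ (sym (swapColumns-a M i (adjacent⇒≢ b≡1+c)))))

m<n⇒n≡1+[n∸1+m]+m : ∀ {m n} → m < n → n ≡ suc (n ℕ.∸ suc m ℕ.+ m)
m<n⇒n≡1+[n∸1+m]+m {m} m<n = sym (trans (sym (ℕ.+-suc _ m)) (ℕ.m∸n+n≡m m<n))

det-equalColumns : ∀ {n} (M : PMat n) a b → a ≢ b → (∀ i → M i a ≈ M i b) → detₚ M ≈ []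
det-equalColumns M a b a≢b col with ℕ.<-cmp (toℕ a) (toℕ b)
... | tri< a<b _ _ = det-equalColumns-at _ M a b (m<n⇒n≡1+[n∸1+m]+m a<b) col
... | tri≈ _ a≡b _ = ⊥-elim (a≢b (Fin.toℕ-injective a≡b))
... | tri> _ _ b<a = det-equalColumns-at _ M b a (m<n⇒n≡1+[n∸1+m]+m b<a) (≈-sym ∘ col)

det-setColumn-sum : ∀ {n} k (M : PMat n) m (v : Fin k → Fin n → Poly) →
                    detₚ (setColumn M m (λ i → sumₚ (λ l → v l i))) ≈
                    sumₚ (λ l → detₚ (setColumn M m (v l)))
det-setColumn-sum zero    M m v =
  det-linear-* m [] _ (setColumn M m (λ _ → [])) (AgreeOff-setColumn M m _ _) (λ i → ≡⇒≈ (setColumn-≡ M m _ i))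
det-setColumn-sum (suc k) M m v =
  ≈-trans (det-linear-+ m _ (setColumn M m (v zero)) (setColumn M m rest)
             (AgreeOff-setColumn M m _ _) (AgreeOff-setColumn M m _ _)
             (λ i → ≡⇒≈ (trans (setColumn-≡ M m (λ i → v zero i + rest i) i)
                               (sym (cong₂ _+_ (setColumn-≡ M m (v zero) i) (setColumn-≡ M m rest i))))))
          (+-congˡ (detₚ (setColumn M m (v zero))) (det-setColumn-sum k M m (v ∘ suc)))
  where
  rest : _ → Poly
  rest i = sumₚ (λ l → v (suc l) i)

det-setColumn-combination : ∀ {n} (M : PMat n) m (α : Fin n → Poly) →
                            detₚ (setColumn M m (λ i → sumₚ (λ j → α j * M i j))) ≈ α m * detₚ M
det-setColumn-combination M m α = begin
  detₚ (setColumn M m (λ i → sumₚ (λ j → α j * M i j)))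
    ≈⟨ det-setColumn-sum _ M m (λ j i → α j * M i j) ⟩
  sumₚ (λ j → detₚ (setColumn M m (λ i → α j * M i j)))
    ≈⟨ sumₚ-cong factor ⟩
  sumₚ (λ j → α j * detₚ (setColumn M m (λ i → M i j)))
    ≈⟨ sumₚ-single _ m others ⟩
  α m * detₚ (setColumn M m (λ i → M i m))
    ≈⟨ *-congˡ (α m) (det-cong λ i j → ≡⇒≈ (setColumn-self M m i j)) ⟩
  α m * detₚ M ∎
  where
  factor : ∀ j → detₚ (setColumn M m (λ i → α j * M i j)) ≈ α j * detₚ (setColumn M m (λ i → M i j))
  factor j = det-linear-* m (α j) _ _ (AgreeOff-setColumn M m _ _)
    λ i → ≡⇒≈ (trans (setColumn-≡ M m (λ i → α j * M i j) i)
                     (cong (α j *_) (sym (setColumn-≡ M m (λ i → M i j) i))))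
  others : ∀ j → j ≢ m → α j * detₚ (setColumn M m (λ i → M i j)) ≈ []
  others j j≢m = ≈-trans (*-congˡ (α j) (det-equalColumns _ m j (j≢m ∘ sym) equal)) (*-zeroʳ (α j))
    where
    equal : ∀ i → setColumn M m (λ i → M i j) i m ≈ setColumn M m (λ i → M i j) i j
    equal i = ≡⇒≈ (trans (setColumn-≡ M m (λ i → M i j) i) (sym (setColumn-≢ M (λ i → M i j) i j≢m)))

det-columnCombination : ∀ {n} (M : PMat n) m (α : Fin n → Poly) β (u : Fin n → Poly) → α m ≈ 1ₚ →
                        (∀ i → sumₚ (λ j → α j * M i j) ≈ β * u i) →
                        detₚ M ≈ β * detₚ (setColumn M m u)
det-columnCombination M m α β u αm≈1 combination = begin
  detₚ M
    ≈⟨ *-identityˡ (detₚ M) ⟨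
  1ₚ * detₚ M
    ≈⟨ *-congʳ (detₚ M) αm≈1 ⟨
  α m * detₚ M
    ≈⟨ det-setColumn-combination M m α ⟨
  detₚ (setColumn M m (λ i → sumₚ (λ j → α j * M i j)))
    ≈⟨ det-linear-* m β _ _ (AgreeOff-setColumn M m _ _) column ⟩
  β * detₚ (setColumn M m u) ∎
  where
  column : ∀ i → setColumn M m (λ i → sumₚ (λ j → α j * M i j)) i m ≈ β * setColumn M m u i m
  column i = ≈-trans (≡⇒≈ (setColumn-≡ M m (λ i → sumₚ (λ j → α j * M i j)) i))
                     (≈-trans (combination i) (*-congˡ β (≡⇒≈ (sym (setColumn-≡ M m u i)))))

det-rowSums : ∀ {n} (M : PMat n) m p → (∀ i → sumₚ (M i) ≈ p) →
              detₚ M ≈ p * detₚ (setColumn M m (λ _ → 1ₚ))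
det-rowSums M m p rowSum = det-columnCombination M m (λ _ → 1ₚ) p (λ _ → 1ₚ) ≈-refl
  λ i → ≈-trans (sumₚ-cong (λ j → *-identityˡ (M i j))) (≈-trans (rowSum i) (≈-sym (*-identityʳ p)))

withOnes : ∀ {m} → PMat (suc m) → PMat (suc m)
withOnes Q = setColumn Q zero (λ _ → 1ₚ)

det-addMultipleOfColumn : ∀ {n} (M M′ : PMat n) m p β → p ≢ m → AgreeOff m M′ M →
                          (∀ i → M′ i m ≈ M i m + β * M i p) → detₚ M′ ≈ detₚ M
det-addMultipleOfColumn M M′ m p β p≢m M′≈M column = begin
  detₚ M′
    ≈⟨ det-linear-+ m M′ M added M′≈M M′≈added column′ ⟩
  detₚ M + detₚ added
    ≈⟨ +-congˡ (detₚ M) (det-linear-* m β added copied (AgreeOff-setColumn M m _ _) scaled) ⟩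
  detₚ M + β * detₚ copied
    ≈⟨ +-congˡ (detₚ M) (*-congˡ β (det-equalColumns copied m p (p≢m ∘ sym) equal)) ⟩
  detₚ M + β * []
    ≈⟨ +-congˡ (detₚ M) (*-zeroʳ β) ⟩
  detₚ M + []
    ≈⟨ +-identityʳ (detₚ M) ⟩
  detₚ M ∎
  where
  added copied : PMat _
  added  = setColumn M m (λ i → β * M i p)
  copied = setColumn M m (λ i → M i p)
  M′≈added : AgreeOff m M′ added
  M′≈added = AgreeOff-setColumnʳ _ M′≈M
  column′ : ∀ i → M′ i m ≈ M i m + added i m
  column′ i = ≈-trans (column i) (+-congˡ (M i m) (≡⇒≈ (sym (setColumn-≡ M m (λ i → β * M i p) i))))
  scaled : ∀ i → added i m ≈ β * copied i m
  scaled i = ≡⇒≈ (trans (setColumn-≡ M m (λ i → β * M i p) i)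
                        (cong (β *_) (sym (setColumn-≡ M m (λ i → M i p) i))))
  equal : ∀ i → copied i m ≈ copied i p
  equal i = ≡⇒≈ (trans (setColumn-≡ M m (λ i → M i p) i) (sym (setColumn-≢ M (λ i → M i p) i p≢m)))

-- Add the multiples one column at a time: firstColumns k takes its first k columns
-- from M′ and the others from M, and the pivot column p is the same in both.
module _ {n} (M M′ : PMat n) (p : Fin n) (β : Fin n → Poly) (βp≈0 : β p ≈ [])
         (M′≈ : ∀ i j → M′ i j ≈ M i j + β j * M i p) where

  private
    firstColumns : ℕ → PMat n
    firstColumns k i j = if ⌊ toℕ j ℕ.<? k ⌋ then M′ i j else M i j

    pivot-unchanged : ∀ i → M′ i p ≈ M i p
    pivot-unchanged i =
      ≈-trans (M′≈ i p) (≈-trans (+-congˡ (M i p) (*-congʳ (M i p) βp≈0)) (+-identityʳ (M i p)))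

    pivot-firstColumns : ∀ k i → firstColumns k i p ≈ M i p
    pivot-firstColumns k i with toℕ p ℕ.<? k
    ... | yes _ = pivot-unchanged i
    ... | no _  = ≈-refl

    all-firstColumns : ∀ i j → firstColumns n i j ≈ M′ i j
    all-firstColumns i j with toℕ j ℕ.<? n
    ... | yes _   = ≈-refl
    ... | no j≮n  = ⊥-elim (j≮n (Fin.toℕ<n j))

    module _ k (k<n : k < n) where
      m : Fin n
      m = Fin.fromℕ< k<n

      toℕ-m : toℕ m ≡ k
      toℕ-m = Fin.toℕ-fromℕ< k<n

      firstColumns-off-m : AgreeOff m (firstColumns (suc k)) (firstColumns k)
      firstColumns-off-m i j j≢m with toℕ j ℕ.<? suc k | toℕ j ℕ.<? k
      ... | yes _     | yes _   = ≈-refl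
      ... | no _      | no _    = ≈-refl
      ... | yes j<1+k | no j≮k  =
        ⊥-elim (j≢m (Fin.toℕ-injective (trans (ℕ.≤-antisym (ℕ.≤-pred j<1+k) (ℕ.≮⇒≥ j≮k)) (sym toℕ-m))))
      ... | no j≮1+k  | yes j<k = ⊥-elim (j≮1+k (ℕ.m<n⇒m<1+n j<k))

      firstColumns-suc-at-m : ∀ i → firstColumns (suc k) i m ≡ M′ i m
      firstColumns-suc-at-m i with toℕ m ℕ.<? suc k
      ... | yes _  = refl
      ... | no m≮  = ⊥-elim (m≮ (subst (_< suc k) (sym toℕ-m) (ℕ.n<1+n k)))

      firstColumns-at-m : ∀ i → firstColumns k i m ≡ M i m
      firstColumns-at-m i with toℕ m ℕ.<? k
      ... | yes m<k = ⊥-elim (ℕ.<-irrefl toℕ-m m<k)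
      ... | no _    = refl

      det-firstColumns-suc : Dec (p ≡ m) → detₚ (firstColumns (suc k)) ≈ detₚ (firstColumns k)
      det-firstColumns-suc (yes refl) = det-cong λ i j → by-column i j (j Fin.≟ p)
        where
        by-column : ∀ i j → Dec (j ≡ p) → firstColumns (suc k) i j ≈ firstColumns k i j
        by-column i j (yes refl) = ≈-trans (pivot-firstColumns (suc k) i) (≈-sym (pivot-firstColumns k i))
        by-column i j (no j≢p)   = firstColumns-off-m i j j≢p
      det-firstColumns-suc (no p≢m) =
        det-addMultipleOfColumn (firstColumns k) (firstColumns (suc k)) m p (β m) p≢m firstColumns-off-m
          λ i → ≈-trans (≡⇒≈ (firstColumns-suc-at-m i))
                (≈-trans (M′≈ i m) (+-cong (≡⇒≈ (sym (firstColumns-at-m i)))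
                                           (*-congˡ (β m) (≈-sym (pivot-firstColumns k i)))))

    det-firstColumns : ∀ k → k ≤ n → detₚ (firstColumns k) ≈ detₚ M
    det-firstColumns zero    _   = ≈-refl
    det-firstColumns (suc k) k<n =
      ≈-trans (det-firstColumns-suc k k<n (p Fin.≟ m k k<n)) (det-firstColumns k (ℕ.<⇒≤ k<n))

  det-addPivotMultiples : detₚ M′ ≈ detₚ M
  det-addPivotMultiples = ≈-trans (det-cong λ i j → ≈-sym (all-firstColumns i j)) (det-firstColumns n ℕ.≤-refl)

det-addTwoPivotMultiples : ∀ {n} (M M′ : PMat n) p q (β γ : Fin n → Poly) →
                           β p ≈ [] → β q ≈ [] → γ q ≈ [] →
                           (∀ i j → M′ i j ≈ M i j + β j * M i p + γ j * M i q) → detₚ M′ ≈ detₚ M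
det-addTwoPivotMultiples M M′ p q β γ βp≈0 βq≈0 γq≈0 M′≈ =
  ≈-trans (det-addPivotMultiples M₁ M′ q γ γq≈0 λ i j →
             ≈-trans (M′≈ i j) (+-congˡ (M₁ i j) (*-congˡ (γ j) (≈-sym (q-unchanged i)))))
          (det-addPivotMultiples M M₁ p β βp≈0 λ i j → ≈-refl)
  where
  M₁ : PMat _
  M₁ i j = M i j + β j * M i p
  q-unchanged : ∀ i → M₁ i q ≈ M i q
  q-unchanged i = ≈-trans (+-congˡ (M i q) (*-congʳ (M i p) βq≈0)) (+-identityʳ (M i q))

punchIn-↑ˡ : ∀ {m} n (j : Fin (suc m)) (k : Fin m) → punchIn (j ↑ˡ n) (k ↑ˡ n) ≡ punchIn j k ↑ˡ n
punchIn-↑ˡ n zero    k       = refl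
punchIn-↑ˡ n (suc j) zero    = refl
punchIn-↑ˡ n (suc j) (suc k) = cong suc (punchIn-↑ˡ n j k)

punchIn-↑ʳ : ∀ m {n} (j : Fin (suc m)) (l : Fin n) → punchIn (j ↑ˡ n) (m ↑ʳ l) ≡ suc m ↑ʳ l
punchIn-↑ʳ zero    zero    l = refl
punchIn-↑ʳ (suc m) zero    l = refl
punchIn-↑ʳ (suc m) (suc j) l = cong suc (punchIn-↑ʳ m j l)

-- Expanding along the first row, only the columns of the upper-left block contribute,
-- and their minors are again block lower-triangular.
det-blockLowerTriangular : ∀ m {n} (M : PMat (m ℕ.+ n)) → (∀ i j → M (i ↑ˡ n) (m ↑ʳ j) ≈ []) →
  detₚ M ≈ detₚ (λ i j → M (i ↑ˡ n) (j ↑ˡ n)) * detₚ (λ i j → M (m ↑ʳ i) (m ↑ʳ j))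
det-blockLowerTriangular zero    M _ = ≈-sym (*-identityˡ (detₚ M))
det-blockLowerTriangular (suc m) {n} M upperRight≈0 = begin
  sumₚ (laplaceTerm M)
    ≈⟨ sumₚ-↑ (suc m) (laplaceTerm M) ⟩
  sumₚ (λ j → laplaceTerm M (j ↑ˡ n)) + sumₚ (λ j → laplaceTerm M (suc m ↑ʳ j))
    ≈⟨ +-cong (sumₚ-cong left) (sumₚ-zero _ right) ⟩
  sumₚ (λ j → laplaceTerm TL j * detₚ BR) + []
    ≈⟨ +-identityʳ _ ⟩
  sumₚ (λ j → laplaceTerm TL j * detₚ BR)
    ≈⟨ sumₚ-*ʳ (laplaceTerm TL) (detₚ BR) ⟨
  detₚ TL * detₚ BR ∎
  where
  TL : PMat (suc m)
  TL i j = M (i ↑ˡ n) (j ↑ˡ n)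
  BR : PMat n
  BR i j = M (suc m ↑ʳ i) (suc m ↑ʳ j)
  right : ∀ j → laplaceTerm M (suc m ↑ʳ j) ≈ []
  right j = ≈-trans (sign-cong (toℕ (suc m ↑ʳ j)) (*-congʳ (detₚ (minor (suc m ↑ʳ j) M)) (upperRight≈0 zero j)))
                    (sign-zero (toℕ (suc m ↑ʳ j)))
  rearrange : ∀ a b c → a * (b * c) ≈ c * (a * b)
  rearrange = solve-∀ Poly-ring
  left : ∀ j → laplaceTerm M (j ↑ˡ n) ≈ laplaceTerm TL j * detₚ BR
  left j = begin
    sign (toℕ (j ↑ˡ n)) (M zero (j ↑ˡ n) * detₚ (minor (j ↑ˡ n) M))
      ≡⟨ cong (λ t → sign t (TL zero j * detₚ (minor (j ↑ˡ n) M))) (Fin.toℕ-↑ˡ j n) ⟩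
    sign (toℕ j) (TL zero j * detₚ (minor (j ↑ˡ n) M))
      ≈⟨ sign-cong (toℕ j) (≈-trans (*-congˡ (TL zero j) minor-blocks)
                                    (rearrange (TL zero j) (detₚ (minor j TL)) (detₚ BR))) ⟩
    sign (toℕ j) (detₚ BR * (TL zero j * detₚ (minor j TL)))
      ≈⟨ sign-*ˡ (toℕ j) (detₚ BR) _ ⟩
    detₚ BR * laplaceTerm TL j
      ≈⟨ *-comm (detₚ BR) (laplaceTerm TL j) ⟩
    laplaceTerm TL j * detₚ BR ∎
    where
    minor-upperRight≈0 : ∀ i l → minor (j ↑ˡ n) M (i ↑ˡ n) (m ↑ʳ l) ≈ []
    minor-upperRight≈0 i l rewrite punchIn-↑ʳ m j l = upperRight≈0 (suc i) l
    minor-blocks : detₚ (minor (j ↑ˡ n) M) ≈ detₚ (minor j TL) * detₚ BR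
    minor-blocks = ≈-trans (det-blockLowerTriangular m (minor (j ↑ˡ n) M) minor-upperRight≈0)
      (*-cong (det-cong λ i k → ≡⇒≈ (cong (M (suc i ↑ˡ n)) (punchIn-↑ˡ n j k)))
              (det-cong λ i l → ≡⇒≈ (cong (M (suc m ↑ʳ i)) (punchIn-↑ʳ m j l))))

Deg≤-sign : ∀ k {p d} → Deg≤ p d → Deg≤ (sign k p) d
Deg≤-sign zero          p≤d = p≤d
Deg≤-sign (suc zero)    p≤d = Deg≤-neg p≤d
Deg≤-sign (suc (suc k)) p≤d = Deg≤-sign k p≤d

Deg≤-sumₚ : ∀ {n d} (f : Fin n → Poly) → (∀ j → Deg≤ (f j) d) → Deg≤ (sumₚ f) d
Deg≤-sumₚ {zero}  f _   = deg≤ λ _ _ → refl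
Deg≤-sumₚ {suc n} f f≤d = Deg≤-+ (f≤d zero) (Deg≤-sumₚ (f ∘ suc) (f≤d ∘ suc))

det-Deg≤ : ∀ {n d} (M : PMat n) → (∀ i j → Deg≤ (M i j) d) → Deg≤ (detₚ M) (n ℕ.* d)
det-Deg≤ {zero}  M _   = deg≤ λ { (suc k) _ → refl }
det-Deg≤ {suc n} M M≤d = Deg≤-sumₚ (laplaceTerm M) λ j →
  Deg≤-sign (toℕ j) (Deg≤-* (M≤d zero j) (det-Deg≤ (minor j M) λ i k → M≤d (suc i) (punchIn j k)))

-- Only the Laplace term of the diagonal entry M₀₀ reaches degree n.
det-Monic : ∀ {n} (M : PMat n) → (∀ i → Monic (M i i) 1) → (∀ i j → i ≢ j → Deg≤ (M i j) 0) →
            Monic (detₚ M) n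
det-Monic {zero}  M _ _ = monic (deg≤ λ { (suc k) _ → refl }) refl
det-Monic {suc n} M diag off =
  monic (Deg≤-+ (bounded diag-term) (Deg≤-mono (ℕ.n≤1+n n) rest≤n))
        (trans (coeff-+ (laplaceTerm M zero) _ (suc n))
               (cong₂ ℤ._+_ (leading diag-term) (vanishes rest≤n (suc n) (ℕ.n<1+n n))))
  where
  diag-term : Monic (laplaceTerm M zero) (suc n)
  diag-term = Monic-* (diag zero)
    (det-Monic (minor zero M) (diag ∘ suc) λ i j i≢j → off (suc i) (suc j) (i≢j ∘ Fin.suc-injective))
  entries≤1 : ∀ i j → Deg≤ (M i j) 1
  entries≤1 i j with i Fin.≟ j
  ... | yes refl = bounded (diag i)
  ... | no i≢j   = Deg≤-mono z≤n (off i j i≢j)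
  rest≤n : Deg≤ (sumₚ (λ j → laplaceTerm M (suc j))) n
  rest≤n = Deg≤-sumₚ _ λ j → Deg≤-sign (toℕ (suc j))
    (subst (Deg≤ _) (ℕ.*-identityʳ n)
      (Deg≤-* (off zero (suc j) λ ()) (det-Deg≤ (minor (suc j) M) λ i k → entries≤1 (suc i) _)))

∘-sumₚ : ∀ {n} (f : Fin n → Poly) q → sumₚ f ∘ₚ q ≈ sumₚ (λ j → f j ∘ₚ q)
∘-sumₚ {zero}  f q = ≈-refl
∘-sumₚ {suc n} f q = ≈-trans (∘-+ (f zero) _ q) (+-congˡ (f zero ∘ₚ q) (∘-sumₚ (f ∘ suc) q))

∘-sign : ∀ k p q → sign k p ∘ₚ q ≈ sign k (p ∘ₚ q)
∘-sign zero          p q = ≈-refl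
∘-sign (suc zero)    p q = ∘-neg p q
∘-sign (suc (suc k)) p q = ∘-sign k p q

det-∘ : ∀ {n} (M : PMat n) q → detₚ M ∘ₚ q ≈ detₚ (λ i j → M i j ∘ₚ q)
det-∘ {zero}  M q = const-∘ (+ 1) q
det-∘ {suc n} M q = ≈-trans (∘-sumₚ (laplaceTerm M) q) (sumₚ-cong λ j →
  ≈-trans (∘-sign (toℕ j) (M zero j * detₚ (minor j M)) q)
          (sign-cong (toℕ j) (≈-trans (∘-* (M zero j) (detₚ (minor j M)) q)
                                      (*-congˡ (M zero j ∘ₚ q) (det-∘ (minor j M) q)))))

-- Characteristic matrices and distances

-- charPoly M is definitionally detₚ (charMatrix Xₚ M).
charMatrix : ∀ {n} → Poly → Matrix n → PMat n
charMatrix x M i j = (if δ i j then x else []) + negₚ (constₚ (M i j))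

charMatrix-diagonal : ∀ {n} x (M : Matrix n) i → charMatrix x M i i ≡ x + negₚ (constₚ (M i i))
charMatrix-diagonal x M i rewrite δ-refl i = refl

charMatrix-offDiagonal : ∀ {n} x (M : Matrix n) {i j} → i ≢ j → charMatrix x M i j ≡ negₚ (constₚ (M i j))
charMatrix-offDiagonal x M i≢j rewrite δ-≢ i≢j = refl

sumₚ-charMatrix : ∀ {n} x (M : Matrix n) i → sumₚ (charMatrix x M i) ≈ x + negₚ (constₚ (sumZ (M i)))
sumₚ-charMatrix x M i = begin
  sumₚ (charMatrix x M i)
    ≈⟨ sumₚ-+ (λ j → if δ i j then x else []) (λ j → negₚ (constₚ (M i j))) ⟩
  sumₚ (λ j → if δ i j then x else []) + sumₚ (λ j → negₚ (constₚ (M i j)))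
    ≈⟨ +-cong (sumₚ-δ i x) (≈-trans (sumₚ-neg (λ j → constₚ (M i j))) (neg-cong (sumₚ-const (M i)))) ⟩
  x + negₚ (constₚ (sumZ (M i))) ∎

charMatrix-∘ : ∀ {n} (M : Matrix n) q i j → charMatrix Xₚ M i j ∘ₚ q ≈ charMatrix q M i j
charMatrix-∘ M q i j with δ i j
... | true  = ≈-trans (∘-+ Xₚ (negₚ (constₚ (M i j))) q) (+-cong (Xₚ-∘ q) constant)
  where constant = ≈-trans (∘-neg (constₚ (M i j)) q) (neg-cong (const-∘ (M i j) q))
... | false = ≈-trans (∘-neg (constₚ (M i j)) q) (neg-cong (const-∘ (M i j) q))

charPoly-∘ : ∀ {n} (M : Matrix n) q → charPoly M ∘ₚ q ≈ detₚ (charMatrix q M)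
charPoly-∘ M q = ≈-trans (det-∘ (charMatrix Xₚ M) q) (det-cong (charMatrix-∘ M q))

IntegralSpectrum⇔Splits : ∀ {n} (M : Matrix n) → IntegralSpectrum M ⇔ Splits n (charPoly M)
IntegralSpectrum⇔Splits M = mk⇔ (λ (ls , e) → ls , mk≈ e) (λ (ls , e) → ls , coeff-≡ e)

IntegralSpectrum⇔Splits-∘X- : ∀ {n} (M : Matrix n) a → IntegralSpectrum M ⇔ Splits n (charPoly M ∘ₚ X- a)
IntegralSpectrum⇔Splits-∘X- M a = ⇔-trans (IntegralSpectrum⇔Splits M) (⇔-sym (Splits-∘X-⇔ (charPoly M) a))

det-charMatrix-X-Monic : ∀ {n} (M : Matrix n) a → Monic (detₚ (charMatrix (X- a) M)) n
det-charMatrix-X-Monic M a = det-Monic (charMatrix (X- a) M) diagonal offDiagonal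
  where
  diagonal : ∀ i → Monic (charMatrix (X- a) M i i) 1
  diagonal i rewrite charMatrix-diagonal (X- a) M i =
    Monic-cong (≈-sym (X-+const a (- M i i))) (Monic-X- (a ℤ.- - M i i))
  offDiagonal : ∀ i j → i ≢ j → Deg≤ (charMatrix (X- a) M i j) 0
  offDiagonal i j i≢j rewrite charMatrix-offDiagonal (X- a) M i≢j = Deg≤-neg (Deg≤-const (M i j))

sumZ-+ : ∀ {n} (f g : Fin n → ℤ) → sumZ (λ j → f j ℤ.+ g j) ≡ sumZ f ℤ.+ sumZ g
sumZ-+ {zero}  f g = refl
sumZ-+ {suc n} f g rewrite sumZ-+ (f ∘ suc) (g ∘ suc) =
  interchange (f zero) (g zero) (sumZ (f ∘ suc)) (sumZ (g ∘ suc))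
  where
  interchange : ∀ a b c d → a ℤ.+ b ℤ.+ (c ℤ.+ d) ≡ a ℤ.+ c ℤ.+ (b ℤ.+ d)
  interchange = solve-∀ ℤ.ring

sumZ-neg : ∀ {n} (f : Fin n → ℤ) → sumZ (λ j → - f j) ≡ - sumZ f
sumZ-neg {zero}  f = refl
sumZ-neg {suc n} f rewrite sumZ-neg (f ∘ suc) = sym (ℤ.neg-distrib-+ (f zero) _)

sumZ-zero : ∀ {n} (f : Fin n → ℤ) → (∀ j → f j ≡ + 0) → sumZ f ≡ + 0
sumZ-zero {zero}  f f≡0 = refl
sumZ-zero {suc n} f f≡0 rewrite f≡0 zero = trans (ℤ.+-identityˡ _) (sumZ-zero (f ∘ suc) (f≡0 ∘ suc))

sumZ-single : ∀ {n} (f : Fin n → ℤ) i → (∀ j → j ≢ i → f j ≡ + 0) → sumZ f ≡ f i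
sumZ-single {suc n} f zero    f≡0 rewrite sumZ-zero (f ∘ suc) (λ j → f≡0 (suc j) λ ()) = ℤ.+-identityʳ (f zero)
sumZ-single {suc n} f (suc i) f≡0 rewrite f≡0 zero (λ ()) =
  trans (ℤ.+-identityˡ _) (sumZ-single (f ∘ suc) i λ j j≢i → f≡0 (suc j) (j≢i ∘ Fin.suc-injective))

sumZ-δ : ∀ {n} (i : Fin n) c → sumZ (λ j → if δ i j then c else + 0) ≡ c
sumZ-δ i c = trans (sumZ-single _ i λ j j≢i → cong (λ b → if b then c else + 0) (δ-≢ (j≢i ∘ sym)))
                   (cong (λ b → if b then c else + 0) (δ-refl i))

sumZ-distLaplacian : ∀ {n} (G : Graph n) i → sumZ (distLaplacian G i) ≡ + 0
sumZ-distLaplacian G i =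
  trans (sumZ-+ (λ j → if δ i j then transmission G i else + 0) (λ j → - distMatrix G i j))
        (trans (cong₂ ℤ._+_ (sumZ-δ i (transmission G i)) (sumZ-neg (distMatrix G i)))
               (ℤ.+-inverseʳ (transmission G i)))

sumZ-adjMatrix : ∀ {n} (G : Graph n) i → sumZ (adjMatrix G i) ≡ + degree G i
sumZ-adjMatrix G i = count (adj G i)
  where
  count : ∀ {n} (f : Fin n → Bool) → sumZ (λ j → if f j then + 1 else + 0) ≡ + countF f
  count {zero}  f = refl
  count {suc n} f rewrite count (f ∘ suc) with f zero
  ... | true  = refl
  ... | false = refl

charMatrix-distLaplacian-off : ∀ {n} (G : Graph n) {i j} → i ≢ j →
                               charMatrix Xₚ (distLaplacian G) i j ≈ constₚ (+ dist G i j)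
charMatrix-distLaplacian-off G {i} {j} i≢j rewrite charMatrix-offDiagonal Xₚ (distLaplacian G) i≢j | δ-≢ i≢j =
  ≡⇒≈ (cong constₚ (neg-sub (+ dist G i j)))
  where
  neg-sub : ∀ x → - (+ 0 ℤ.- x) ≡ x
  neg-sub = solve-∀ ℤ.ring

sumₚ-charMatrix-distLaplacian : ∀ {n} (G : Graph n) i → sumₚ (charMatrix Xₚ (distLaplacian G) i) ≈ Xₚ
sumₚ-charMatrix-distLaplacian G i = begin
  sumₚ (charMatrix Xₚ (distLaplacian G) i)
    ≈⟨ sumₚ-charMatrix Xₚ (distLaplacian G) i ⟩
  Xₚ + negₚ (constₚ (sumZ (distLaplacian G i)))
    ≡⟨ cong (λ k → Xₚ + negₚ (constₚ k)) (sumZ-distLaplacian G i) ⟩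
  Xₚ + negₚ (constₚ (+ 0))
    ≡⟨⟩
  Xₚ ∎

module RegularShift {m} (G : Graph (suc m)) r (reg : Regular G r) (t : ℤ) where

  Q : PMat (suc m)
  Q = charMatrix (X- (t ℤ.- + r)) (adjMatrix G)

  rowSum-Q : ∀ i → sumₚ (Q i) ≈ X- t
  rowSum-Q i = begin
    sumₚ (Q i)
      ≈⟨ sumₚ-charMatrix (X- (t ℤ.- + r)) (adjMatrix G) i ⟩
    X- (t ℤ.- + r) + negₚ (constₚ (sumZ (adjMatrix G i)))
      ≡⟨ cong (λ k → X- (t ℤ.- + r) + negₚ (constₚ k)) (trans (sumZ-adjMatrix G i) (cong +_ (reg i))) ⟩
    X- (t ℤ.- + r) + constₚ (- + r)
      ≈⟨ X-+const (t ℤ.- + r) (- + r) ⟩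
    X- (t ℤ.- + r ℤ.- - + r)
      ≡⟨ cong X-_ (cancel t (+ r)) ⟩
    X- t ∎
    where
    cancel : ∀ t r → t ℤ.- r ℤ.- - r ≡ t
    cancel = solve-∀ ℤ.ring

  charPoly-∘X- : charPoly (adjMatrix G) ∘ₚ X- (t ℤ.- + r) ≈ X- t * detₚ (withOnes Q)
  charPoly-∘X- = ≈-trans (charPoly-∘ (adjMatrix G) (X- (t ℤ.- + r))) (det-rowSums Q zero (X- t) rowSum-Q)

  charPoly-∘X-Monic : Monic (charPoly (adjMatrix G) ∘ₚ X- (t ℤ.- + r)) (suc m)
  charPoly-∘X-Monic =
    Monic-cong (≈-sym (charPoly-∘ (adjMatrix G) (X- (t ℤ.- + r)))) (det-charMatrix-X-Monic (adjMatrix G) (t ℤ.- + r))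

anyF-true : ∀ {n} (f : Fin n → Bool) w → f w ≡ true → anyF f ≡ true
anyF-true f zero    fw≡true rewrite fw≡true = refl
anyF-true f (suc w) fw≡true rewrite anyF-true (f ∘ suc) w fw≡true = Bool.∨-zeroʳ (f zero)

anyF-false : ∀ {n} (f : Fin n → Bool) → (∀ w → f w ≡ false) → anyF f ≡ false
anyF-false {zero}  f _     = refl
anyF-false {suc n} f f≡false rewrite f≡false zero = anyF-false (f ∘ suc) (f≡false ∘ suc)

minFrom-least : ∀ n f k → k < n → f k ≡ true → (∀ i → i < k → f i ≡ false) → minFrom n f ≡ k
minFrom-least (suc n) f zero    _         fk≡true _     rewrite fk≡true = refl
minFrom-least (suc n) f (suc k) (s≤s k<n) fk≡true below rewrite below 0 (s≤s z≤n) =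
  cong suc (minFrom-least n (f ∘ suc) k k<n fk≡true λ i i<k → below (suc i) (s≤s i<k))

≢⇒1<n : ∀ {n} {u v : Fin n} → u ≢ v → 1 < n
≢⇒1<n {suc n} u≢v = s≤s (ℕ.≤-<-trans z≤n (Fin.toℕ<n (punchOut u≢v)))
≢⇒1<n {zero} {()}

≢₃⇒2<n : ∀ {n} {u v w : Fin n} → u ≢ v → u ≢ w → v ≢ w → 2 < n
≢₃⇒2<n {suc n} u≢v u≢w v≢w = s≤s (≢⇒1<n (v≢w ∘ Fin.punchOut-injective u≢v u≢w))
≢₃⇒2<n {zero} {()}

adj⇒≢ : ∀ {n} (G : Graph n) {u v} → adj G u v ≡ true → u ≢ v
adj⇒≢ G {u} uv≡true refl with trans (sym uv≡true) (adj-irref G u)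
... | ()

reach-1-adj : ∀ {n} (G : Graph n) {u v} → adj G u v ≡ true → reach G 1 u v ≡ true
reach-1-adj G {u} {v} uv≡true =
  trans (cong (δ u v ∨_) (anyF-true _ v (cong₂ _∧_ uv≡true (δ-refl v)))) (Bool.∨-zeroʳ (δ u v))

reach-1-nonadj : ∀ {n} (G : Graph n) {u v} → u ≢ v → adj G u v ≡ false → reach G 1 u v ≡ false
reach-1-nonadj G {u} {v} u≢v uv≡false rewrite δ-≢ u≢v = anyF-false _ step
  where
  step : ∀ w → (adj G u w ∧ δ w v) ≡ false
  step w with w Fin.≟ v
  ... | yes refl = cong (_∧ true) uv≡false
  ... | no _     = Bool.∧-zeroʳ (adj G u w)

reach-2-common : ∀ {n} (G : Graph n) {u v w} → adj G u w ≡ true → adj G w v ≡ true → reach G 2 u v ≡ true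
reach-2-common G {u} {v} {w} uw≡true wv≡true =
  trans (cong (reach G 1 u v ∨_) (anyF-true _ w (cong₂ _∧_ uw≡true (reach-1-adj G wv≡true))))
        (Bool.∨-zeroʳ (reach G 1 u v))

dist-adj : ∀ {n} (G : Graph n) {u v} → adj G u v ≡ true → dist G u v ≡ 1
dist-adj {n} G uv≡true = minFrom-least n _ 1 (≢⇒1<n (adj⇒≢ G uv≡true)) (reach-1-adj G uv≡true)
  λ { zero _ → δ-≢ (adj⇒≢ G uv≡true) ; (suc _) (s≤s ()) }

dist-commonNeighbour : ∀ {n} (G : Graph n) {u v w} → u ≢ v → adj G u v ≡ false →
                       adj G u w ≡ true → adj G w v ≡ true → dist G u v ≡ 2
dist-commonNeighbour {n} G u≢v uv≡false uw≡true wv≡true =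
  minFrom-least n _ 2 (≢₃⇒2<n u≢v (adj⇒≢ G uw≡true) (adj⇒≢ G wv≡true ∘ sym))
                      (reach-2-common G uw≡true wv≡true)
  λ { zero _ → δ-≢ u≢v ; (suc zero) _ → reach-1-nonadj G u≢v uv≡false ; (suc (suc _)) (s≤s (s≤s ())) }

↑ˡ≢↑ʳ : ∀ {m n} (a : Fin m) (b : Fin n) → a ↑ˡ n ≢ m ↑ʳ b
↑ˡ≢↑ʳ {m} {n} a b eq
  with trans (sym (Fin.splitAt-↑ˡ m a n)) (trans (cong (splitAt m) eq) (Fin.splitAt-↑ʳ m n b))
... | ()

module _ {n₁ n₂} (G₁ : Graph n₁) (G₂ : Graph n₂) where

  adj-join-↑ˡ : ∀ a b → adj (join G₁ G₂) (a ↑ˡ n₂) (b ↑ˡ n₂) ≡ adj G₁ a b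
  adj-join-↑ˡ a b rewrite Fin.splitAt-↑ˡ n₁ a n₂ | Fin.splitAt-↑ˡ n₁ b n₂ = refl

  adj-join-↑ʳ : ∀ a b → adj (join G₁ G₂) (n₁ ↑ʳ a) (n₁ ↑ʳ b) ≡ adj G₂ a b
  adj-join-↑ʳ a b rewrite Fin.splitAt-↑ʳ n₁ n₂ a | Fin.splitAt-↑ʳ n₁ n₂ b = refl

  adj-join-↑ˡ↑ʳ : ∀ a b → adj (join G₁ G₂) (a ↑ˡ n₂) (n₁ ↑ʳ b) ≡ true
  adj-join-↑ˡ↑ʳ a b rewrite Fin.splitAt-↑ˡ n₁ a n₂ | Fin.splitAt-↑ʳ n₁ n₂ b = refl

  adj-join-↑ʳ↑ˡ : ∀ a b → adj (join G₁ G₂) (n₁ ↑ʳ b) (a ↑ˡ n₂) ≡ true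
  adj-join-↑ʳ↑ˡ a b rewrite Fin.splitAt-↑ˡ n₁ a n₂ | Fin.splitAt-↑ʳ n₁ n₂ b = refl

  -- Any vertex w of the other side is a common neighbour.
  dist-join-↑ˡ : Fin n₂ → ∀ {a b} → a ≢ b →
                 dist (join G₁ G₂) (a ↑ˡ n₂) (b ↑ˡ n₂) ≡ (if adj G₁ a b then 1 else 2)
  dist-join-↑ˡ w {a} {b} a≢b with adj G₁ a b in ab
  ... | true  = dist-adj (join G₁ G₂) (trans (adj-join-↑ˡ a b) ab)
  ... | false = dist-commonNeighbour (join G₁ G₂) (a≢b ∘ Fin.↑ˡ-injective n₂ a b) (trans (adj-join-↑ˡ a b) ab)
                  (adj-join-↑ˡ↑ʳ a w) (adj-join-↑ʳ↑ˡ b w)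

  dist-join-↑ʳ : Fin n₁ → ∀ {a b} → a ≢ b →
                 dist (join G₁ G₂) (n₁ ↑ʳ a) (n₁ ↑ʳ b) ≡ (if adj G₂ a b then 1 else 2)
  dist-join-↑ʳ w {a} {b} a≢b with adj G₂ a b in ab
  ... | true  = dist-adj (join G₁ G₂) (trans (adj-join-↑ʳ a b) ab)
  ... | false = dist-commonNeighbour (join G₁ G₂) (a≢b ∘ Fin.↑ʳ-injective n₁ a b) (trans (adj-join-↑ʳ a b) ab)
                  (adj-join-↑ʳ↑ˡ w a) (adj-join-↑ˡ↑ʳ w b)

  dist-join-↑ˡ↑ʳ : ∀ a b → dist (join G₁ G₂) (a ↑ˡ n₂) (n₁ ↑ʳ b) ≡ 1
  dist-join-↑ˡ↑ʳ a b = dist-adj (join G₁ G₂) (adj-join-↑ˡ↑ʳ a b)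

  dist-join-↑ʳ↑ˡ : ∀ a b → dist (join G₁ G₂) (n₁ ↑ʳ b) (a ↑ˡ n₂) ≡ 1
  dist-join-↑ʳ↑ˡ a b = dist-adj (join G₁ G₂) (adj-join-↑ʳ↑ˡ a b)

-- Block matrices and the join

↑-view : ∀ m {n} (i : Fin (m ℕ.+ n)) →
         (Σ (Fin m) λ a → a ↑ˡ n ≡ i) ⊎ (Σ (Fin n) λ b → m ↑ʳ b ≡ i)
↑-view m i with splitAt m i in eq
... | inj₁ a = inj₁ (a , Fin.splitAt⁻¹-↑ˡ eq)
... | inj₂ b = inj₂ (b , Fin.splitAt⁻¹-↑ʳ eq)

module _ {A : Set} {n₁ n₂ : ℕ} where

  byBlock : (Fin n₁ → A) → (Fin n₂ → A) → Fin (n₁ ℕ.+ n₂) → A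
  byBlock f g i = [ f , g ]′ (splitAt n₁ i)

  byBlock-↑ˡ : ∀ f g a → byBlock f g (a ↑ˡ n₂) ≡ f a
  byBlock-↑ˡ f g a rewrite Fin.splitAt-↑ˡ n₁ a n₂ = refl

  byBlock-↑ʳ : ∀ f g b → byBlock f g (n₁ ↑ʳ b) ≡ g b
  byBlock-↑ʳ f g b rewrite Fin.splitAt-↑ʳ n₁ n₂ b = refl

  blockMatrix : (Fin n₁ → Fin n₁ → A) → (Fin n₁ → Fin n₂ → A) →
                (Fin n₂ → Fin n₁ → A) → (Fin n₂ → Fin n₂ → A) →
                Fin (n₁ ℕ.+ n₂) → Fin (n₁ ℕ.+ n₂) → A
  blockMatrix A₁₁ A₁₂ A₂₁ A₂₂ i j =
    byBlock (λ a → byBlock (A₁₁ a) (A₁₂ a) j) (λ b → byBlock (A₂₁ b) (A₂₂ b) j) i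

  module BlockMatrix (A₁₁ : Fin n₁ → Fin n₁ → A) (A₁₂ : Fin n₁ → Fin n₂ → A)
                     (A₂₁ : Fin n₂ → Fin n₁ → A) (A₂₂ : Fin n₂ → Fin n₂ → A) where

    blockMatrix-↑ˡ↑ˡ : ∀ a b → blockMatrix A₁₁ A₁₂ A₂₁ A₂₂ (a ↑ˡ n₂) (b ↑ˡ n₂) ≡ A₁₁ a b
    blockMatrix-↑ˡ↑ˡ a b = trans (byBlock-↑ˡ _ _ a) (byBlock-↑ˡ (A₁₁ a) (A₁₂ a) b)

    blockMatrix-↑ˡ↑ʳ : ∀ a b → blockMatrix A₁₁ A₁₂ A₂₁ A₂₂ (a ↑ˡ n₂) (n₁ ↑ʳ b) ≡ A₁₂ a b
    blockMatrix-↑ˡ↑ʳ a b = trans (byBlock-↑ˡ _ _ a) (byBlock-↑ʳ (A₁₁ a) (A₁₂ a) b)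

    blockMatrix-↑ʳ↑ˡ : ∀ a b → blockMatrix A₁₁ A₁₂ A₂₁ A₂₂ (n₁ ↑ʳ a) (b ↑ˡ n₂) ≡ A₂₁ a b
    blockMatrix-↑ʳ↑ˡ a b = trans (byBlock-↑ʳ _ _ a) (byBlock-↑ˡ (A₂₁ a) (A₂₂ a) b)

    blockMatrix-↑ʳ↑ʳ : ∀ a b → blockMatrix A₁₁ A₁₂ A₂₁ A₂₂ (n₁ ↑ʳ a) (n₁ ↑ʳ b) ≡ A₂₂ a b
    blockMatrix-↑ʳ↑ʳ a b = trans (byBlock-↑ʳ _ _ a) (byBlock-↑ʳ (A₂₁ a) (A₂₂ a) b)

-- The characteristic matrix xI − D^L of a join, with Qᵢ = (x − aᵢ)I − A(Gᵢ) for suitable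
-- shifts aᵢ: the distance is 1 across the two sides and 2 − A(Gᵢ) inside a side.
joinMatrix : ∀ {n₁ n₂} → PMat n₁ → PMat n₂ → PMat (n₁ ℕ.+ n₂)
joinMatrix Q₁ Q₂ =
  blockMatrix (λ a b → Q₁ a b + constₚ (+ 2)) (λ _ _ → 1ₚ) (λ _ _ → 1ₚ) (λ a b → Q₂ a b + constₚ (+ 2))

module JoinMatrix {n₁ n₂} (Q₁ : PMat n₁) (Q₂ : PMat n₂) =
  BlockMatrix (λ a b → Q₁ a b + constₚ (+ 2)) (λ _ _ → 1ₚ) (λ _ _ → 1ₚ) (λ a b → Q₂ a b + constₚ (+ 2))
    renaming ( blockMatrix-↑ˡ↑ˡ to joinMatrix-↑ˡ↑ˡ ; blockMatrix-↑ˡ↑ʳ to joinMatrix-↑ˡ↑ʳ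
             ; blockMatrix-↑ʳ↑ˡ to joinMatrix-↑ʳ↑ˡ ; blockMatrix-↑ʳ↑ʳ to joinMatrix-↑ʳ↑ʳ )

atZero : ∀ {m} → Poly → Poly → Fin (suc m) → Poly
atZero p q zero    = p
atZero p q (suc _) = q

-- Column operations reduce xI − D^L of the join to a block lower-triangular matrix:
-- column z (the first vertex of G₁) becomes the row sums x, column c (the first vertex
-- of G₂) becomes (x − N) times the indicator of G₂, and these two pivots then clear
-- the upper-right block.
module JoinDeterminant {m₁ m₂ : ℕ} (Q₁ : PMat (suc m₁)) (Q₂ : PMat (suc m₂))
  (rowSum₁ : ∀ a → sumₚ (Q₁ a) ≈ X- (+ suc m₁ ℤ.+ + suc m₁ ℤ.+ + suc m₂))
  (rowSum₂ : ∀ b → sumₚ (Q₂ b) ≈ X- (+ suc m₂ ℤ.+ + suc m₂ ℤ.+ + suc m₁)) where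

  n₁ n₂ N : ℕ
  n₁ = suc m₁
  n₂ = suc m₂
  N  = n₁ ℕ.+ n₂

  M : PMat N
  M = joinMatrix Q₁ Q₂

  open JoinMatrix Q₁ Q₂

  rowSum-by-sides : ∀ x y (Q : Fin x → Poly) → sumₚ Q ≈ X- (+ x ℤ.+ + x ℤ.+ + y) →
                    sumₚ (λ b → Q b + constₚ (+ 2)) + sumₚ {y} (λ _ → 1ₚ) ≈ Xₚ
  rowSum-by-sides x y Q rowSum = begin
    sumₚ (λ b → Q b + constₚ (+ 2)) + sumₚ {y} (λ _ → 1ₚ)
      ≈⟨ +-cong (sumₚ-+const Q (+ 2)) (sumₚ-replicate {y} (+ 1)) ⟩
    sumₚ Q + constₚ (+ x ℤ.* + 2) + constₚ (+ y ℤ.* + 1)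
      ≈⟨ +-congʳ (constₚ (+ y ℤ.* + 1)) (+-congʳ (constₚ (+ x ℤ.* + 2)) rowSum) ⟩
    X- (+ x ℤ.+ + x ℤ.+ + y) + constₚ (+ x ℤ.* + 2) + constₚ (+ y ℤ.* + 1)
      ≈⟨ X-+const₂ (+ x ℤ.+ + x ℤ.+ + y) (+ x ℤ.* + 2) (+ y ℤ.* + 1) ⟩
    X- (+ x ℤ.+ + x ℤ.+ + y ℤ.- + x ℤ.* + 2 ℤ.- + y ℤ.* + 1)
      ≡⟨ cong X-_ (balance (+ x) (+ y)) ⟩
    Xₚ ∎
    where
    balance : ∀ x y → x ℤ.+ x ℤ.+ y ℤ.- x ℤ.* + 2 ℤ.- y ℤ.* + 1 ≡ + 0
    balance = solve-∀ ℤ.ring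

  rowSum-M : ∀ i → sumₚ (M i) ≈ Xₚ
  rowSum-M i with ↑-view n₁ i
  ... | inj₁ (a , refl) = begin
    sumₚ (M (a ↑ˡ n₂))
      ≈⟨ sumₚ-↑ n₁ {n₂} (M (a ↑ˡ n₂)) ⟩
    sumₚ {n₁} (λ b → M (a ↑ˡ n₂) (b ↑ˡ n₂)) + sumₚ {n₂} (λ b → M (a ↑ˡ n₂) (n₁ ↑ʳ b))
      ≈⟨ +-cong (sumₚ-cong λ b → ≡⇒≈ (joinMatrix-↑ˡ↑ˡ a b))
                (sumₚ-cong λ b → ≡⇒≈ (joinMatrix-↑ˡ↑ʳ a b)) ⟩
    sumₚ (λ b → Q₁ a b + constₚ (+ 2)) + sumₚ {n₂} (λ _ → 1ₚ)
      ≈⟨ rowSum-by-sides n₁ n₂ (Q₁ a) (rowSum₁ a) ⟩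
    Xₚ ∎
  ... | inj₂ (b , refl) = begin
    sumₚ (M (n₁ ↑ʳ b))
      ≈⟨ sumₚ-↑ n₁ {n₂} (M (n₁ ↑ʳ b)) ⟩
    sumₚ {n₁} (λ a → M (n₁ ↑ʳ b) (a ↑ˡ n₂)) + sumₚ {n₂} (λ a → M (n₁ ↑ʳ b) (n₁ ↑ʳ a))
      ≈⟨ +-cong (sumₚ-cong λ a → ≡⇒≈ (joinMatrix-↑ʳ↑ˡ b a))
                (sumₚ-cong λ a → ≡⇒≈ (joinMatrix-↑ʳ↑ʳ b a)) ⟩
    sumₚ {n₁} (λ _ → 1ₚ) + sumₚ (λ a → Q₂ b a + constₚ (+ 2))
      ≈⟨ +-comm (sumₚ {n₁} (λ _ → 1ₚ)) (sumₚ (λ a → Q₂ b a + constₚ (+ 2))) ⟩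
    sumₚ (λ a → Q₂ b a + constₚ (+ 2)) + sumₚ {n₁} (λ _ → 1ₚ)
      ≈⟨ rowSum-by-sides n₂ n₁ (Q₂ b) (rowSum₂ b) ⟩
    Xₚ ∎

  z c : Fin N
  z = zero ↑ˡ n₂
  c = n₁ ↑ʳ zero

  z≢c : z ≢ c
  z≢c = ↑ˡ≢↑ʳ zero zero

  sides : (Fin n₁ → Poly) → (Fin n₂ → Poly) → Fin N → Poly
  sides = byBlock

  sides-↑ˡ : ∀ f g a → sides f g (a ↑ˡ n₂) ≡ f a
  sides-↑ˡ = byBlock-↑ˡ

  sides-↑ʳ : ∀ f g b → sides f g (n₁ ↑ʳ b) ≡ g b
  sides-↑ʳ = byBlock-↑ʳ

  onSecondSide : Fin N → Poly
  onSecondSide = sides (λ _ → []) (λ _ → 1ₚ)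

  onSecondSide-↑ˡ : ∀ a → onSecondSide (a ↑ˡ n₂) ≡ []
  onSecondSide-↑ˡ = sides-↑ˡ (λ _ → []) (λ _ → 1ₚ)

  onSecondSide-↑ʳ : ∀ b → onSecondSide (n₁ ↑ʳ b) ≡ 1ₚ
  onSecondSide-↑ʳ = sides-↑ʳ (λ _ → []) (λ _ → 1ₚ)

  Mᶻ Mᶻᶜ : PMat N
  Mᶻ  = setColumn M z (λ _ → 1ₚ)
  Mᶻᶜ = setColumn Mᶻ c onSecondSide

  det-M : detₚ M ≈ Xₚ * detₚ Mᶻ
  det-M = det-rowSums M z Xₚ rowSum-M

  -- The columns of G₂, minus n₂ times column z.
  α₁ : Fin n₁ → Poly
  α₁ = atZero (negₚ (constₚ (+ n₂))) []

  α : Fin N → Poly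
  α = sides α₁ (λ _ → 1ₚ)

  α-↑ˡ : ∀ a → α (a ↑ˡ n₂) ≡ α₁ a
  α-↑ˡ = sides-↑ˡ α₁ (λ _ → 1ₚ)

  α-↑ʳ : ∀ b → α (n₁ ↑ʳ b) ≡ 1ₚ
  α-↑ʳ = sides-↑ʳ α₁ (λ _ → 1ₚ)

  combination : ∀ i → sumₚ (λ j → α j * Mᶻ i j) ≈ X- (+ N) * onSecondSide i
  combination i = begin
    sumₚ (λ j → α j * Mᶻ i j)
      ≈⟨ sumₚ-↑ n₁ {n₂} (λ j → α j * Mᶻ i j) ⟩
    sumₚ {n₁} (λ a → α (a ↑ˡ n₂) * Mᶻ i (a ↑ˡ n₂)) + sumₚ {n₂} (λ b → α (n₁ ↑ʳ b) * Mᶻ i (n₁ ↑ʳ b))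
      ≈⟨ +-cong first-side second-side ⟩
    negₚ (constₚ (+ n₂)) + sumₚ (λ b → M i (n₁ ↑ʳ b))
      ≈⟨ by-side (↑-view n₁ i) ⟩
    X- (+ N) * onSecondSide i ∎
    where
    others : ∀ a → a ≢ zero → α (a ↑ˡ n₂) * Mᶻ i (a ↑ˡ n₂) ≈ []
    others zero    0≢0 = ⊥-elim (0≢0 refl)
    others (suc a) _   = ≡⇒≈ (cong (_* Mᶻ i (suc a ↑ˡ n₂)) (α-↑ˡ (suc a)))
    first-side : sumₚ {n₁} (λ a → α (a ↑ˡ n₂) * Mᶻ i (a ↑ˡ n₂)) ≈ negₚ (constₚ (+ n₂))
    first-side = begin
      sumₚ {n₁} (λ a → α (a ↑ˡ n₂) * Mᶻ i (a ↑ˡ n₂))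
        ≈⟨ sumₚ-single _ zero others ⟩
      α z * Mᶻ i z
        ≡⟨ cong₂ _*_ (α-↑ˡ zero) (setColumn-≡ M z (λ _ → 1ₚ) i) ⟩
      negₚ (constₚ (+ n₂)) * 1ₚ
        ≈⟨ *-identityʳ _ ⟩
      negₚ (constₚ (+ n₂)) ∎
    second-side : sumₚ {n₂} (λ b → α (n₁ ↑ʳ b) * Mᶻ i (n₁ ↑ʳ b)) ≈ sumₚ (λ b → M i (n₁ ↑ʳ b))
    second-side = sumₚ-cong λ b → ≈-trans
      (≡⇒≈ (cong₂ _*_ (α-↑ʳ b) (setColumn-≢ M (λ _ → 1ₚ) i (↑ˡ≢↑ʳ zero b ∘ sym))))
      (*-identityˡ (M i (n₁ ↑ʳ b)))
    by-side : (Σ (Fin n₁) λ a → a ↑ˡ n₂ ≡ i) ⊎ (Σ (Fin n₂) λ b → n₁ ↑ʳ b ≡ i) →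
              negₚ (constₚ (+ n₂)) + sumₚ (λ b → M i (n₁ ↑ʳ b)) ≈ X- (+ N) * onSecondSide i
    by-side (inj₁ (a , refl)) = begin
      negₚ (constₚ (+ n₂)) + sumₚ (λ b → M (a ↑ˡ n₂) (n₁ ↑ʳ b))
        ≈⟨ +-congˡ (negₚ (constₚ (+ n₂)))
                   (≈-trans (sumₚ-cong λ b → ≡⇒≈ (joinMatrix-↑ˡ↑ʳ a b)) (sumₚ-replicate {n₂} (+ 1))) ⟩
      negₚ (constₚ (+ n₂)) + constₚ (+ n₂ ℤ.* + 1)
        ≡⟨ cong (λ k → negₚ (constₚ (+ n₂)) + constₚ k) (ℤ.*-identityʳ (+ n₂)) ⟩
      negₚ (constₚ (+ n₂)) + constₚ (+ n₂)
        ≈⟨ -‿inverseˡ (constₚ (+ n₂)) ⟩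
      []
        ≈⟨ *-zeroʳ (X- (+ N)) ⟨
      X- (+ N) * []
        ≡⟨ cong (X- (+ N) *_) (onSecondSide-↑ˡ a) ⟨
      X- (+ N) * onSecondSide (a ↑ˡ n₂) ∎
    by-side (inj₂ (b , refl)) = begin
      negₚ (constₚ (+ n₂)) + sumₚ (λ a → M (n₁ ↑ʳ b) (n₁ ↑ʳ a))
        ≈⟨ +-congˡ (negₚ (constₚ (+ n₂)))
                   (≈-trans (sumₚ-cong λ a → ≡⇒≈ (joinMatrix-↑ʳ↑ʳ b a)) (sumₚ-+const (Q₂ b) (+ 2))) ⟩
      negₚ (constₚ (+ n₂)) + (sumₚ (Q₂ b) + constₚ (+ n₂ ℤ.* + 2))
        ≈⟨ +-comm (negₚ (constₚ (+ n₂))) _ ⟩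
      sumₚ (Q₂ b) + constₚ (+ n₂ ℤ.* + 2) + constₚ (- + n₂)
        ≈⟨ +-congʳ (constₚ (- + n₂)) (+-congʳ (constₚ (+ n₂ ℤ.* + 2)) (rowSum₂ b)) ⟩
      X- (+ n₂ ℤ.+ + n₂ ℤ.+ + n₁) + constₚ (+ n₂ ℤ.* + 2) + constₚ (- + n₂)
        ≈⟨ X-+const₂ (+ n₂ ℤ.+ + n₂ ℤ.+ + n₁) (+ n₂ ℤ.* + 2) (- + n₂) ⟩
      X- (+ n₂ ℤ.+ + n₂ ℤ.+ + n₁ ℤ.- + n₂ ℤ.* + 2 ℤ.- - + n₂)
        ≡⟨ cong X-_ (balance (+ n₁) (+ n₂)) ⟩
      X- (+ N)
        ≈⟨ *-identityʳ (X- (+ N)) ⟨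
      X- (+ N) * 1ₚ
        ≡⟨ cong (X- (+ N) *_) (onSecondSide-↑ʳ b) ⟨
      X- (+ N) * onSecondSide (n₁ ↑ʳ b) ∎
      where
      balance : ∀ x y → y ℤ.+ y ℤ.+ x ℤ.- y ℤ.* + 2 ℤ.- - y ≡ x ℤ.+ y
      balance = solve-∀ ℤ.ring

  det-Mᶻ : detₚ Mᶻ ≈ X- (+ N) * detₚ Mᶻᶜ
  det-Mᶻ = det-columnCombination Mᶻ c α (X- (+ N)) onSecondSide (≡⇒≈ (α-↑ʳ zero)) combination

  β₁ γ₁ : Fin n₁ → Poly
  β₁ = atZero [] (constₚ (- + 2))
  γ₁ = atZero [] 1ₚ

  β₂ γ₂ : Fin n₂ → Poly
  β₂ = atZero [] (constₚ (- + 1))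
  γ₂ = atZero [] (constₚ (- + 1))

  β γ : Fin N → Poly
  β = sides β₁ β₂
  γ = sides γ₁ γ₂

  L : PMat N
  L = blockMatrix (withOnes Q₁) (λ _ _ → []) (λ _ → atZero 1ₚ []) (withOnes Q₂)

  open BlockMatrix (withOnes Q₁) (λ _ _ → []) (λ _ → atZero 1ₚ []) (withOnes Q₂)
    renaming ( blockMatrix-↑ˡ↑ˡ to L-↑ˡ↑ˡ ; blockMatrix-↑ˡ↑ʳ to L-↑ˡ↑ʳ
             ; blockMatrix-↑ʳ↑ˡ to L-↑ʳ↑ˡ ; blockMatrix-↑ʳ↑ʳ to L-↑ʳ↑ʳ )

  Mᶻᶜ-z : ∀ i → Mᶻᶜ i z ≡ 1ₚ
  Mᶻᶜ-z i = trans (setColumn-≢ Mᶻ onSecondSide i z≢c) (setColumn-≡ M z (λ _ → 1ₚ) i)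

  Mᶻᶜ-c : ∀ i → Mᶻᶜ i c ≡ onSecondSide i
  Mᶻᶜ-c i = setColumn-≡ Mᶻ c onSecondSide i

  Mᶻᶜ-other : ∀ i {j} → j ≢ z → j ≢ c → Mᶻᶜ i j ≡ M i j
  Mᶻᶜ-other i j≢z j≢c = trans (setColumn-≢ Mᶻ onSecondSide i j≢c) (setColumn-≢ M (λ _ → 1ₚ) i j≢z)

  Mᶻᶜ-first : ∀ i b → Mᶻᶜ i (suc b ↑ˡ n₂) ≡ M i (suc b ↑ˡ n₂)
  Mᶻᶜ-first i b = Mᶻᶜ-other i suc≢zero (↑ˡ≢↑ʳ (suc b) zero)
    where
    suc≢zero : suc b ↑ˡ n₂ ≢ z
    suc≢zero eq with Fin.↑ˡ-injective n₂ (suc b) zero eq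
    ... | ()

  Mᶻᶜ-second : ∀ i b → Mᶻᶜ i (n₁ ↑ʳ suc b) ≡ M i (n₁ ↑ʳ suc b)
  Mᶻᶜ-second i b = Mᶻᶜ-other i (↑ˡ≢↑ʳ zero (suc b) ∘ sym) suc≢zero
    where
    suc≢zero : n₁ ↑ʳ suc b ≢ c
    suc≢zero eq with Fin.↑ʳ-injective n₁ (suc b) zero eq
    ... | ()

  β-↑ˡ : ∀ a → β (a ↑ˡ n₂) ≡ β₁ a
  β-↑ˡ = sides-↑ˡ β₁ β₂

  β-↑ʳ : ∀ b → β (n₁ ↑ʳ b) ≡ β₂ b
  β-↑ʳ = sides-↑ʳ β₁ β₂

  γ-↑ˡ : ∀ a → γ (a ↑ˡ n₂) ≡ γ₁ a
  γ-↑ˡ = sides-↑ˡ γ₁ γ₂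

  γ-↑ʳ : ∀ b → γ (n₁ ↑ʳ b) ≡ γ₂ b
  γ-↑ʳ = sides-↑ʳ γ₁ γ₂

  entry-by-values : ∀ {l m b g e l′ m′ b′ g′ e′} → l ≡ l′ → m ≡ m′ → b ≡ b′ → g ≡ g′ → e ≡ e′ →
                    l′ ≈ m′ + b′ * 1ₚ + g′ * e′ → l ≈ m + b * 1ₚ + g * e
  entry-by-values refl refl refl refl refl eq = eq

  absorb : ∀ x k₁ k₂ k₃ e → k₁ + k₂ * 1ₚ + k₃ * e ≈ [] → x ≈ x + k₁ + k₂ * 1ₚ + k₃ * e
  absorb x k₁ k₂ k₃ e k≈0 =
    ≈-sym (≈-trans (regroup x k₁ k₂ k₃ 1ₚ e) (≈-trans (+-congˡ x k≈0) (+-identityʳ x)))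
    where
    regroup : ∀ x k₁ k₂ k₃ o e → x + k₁ + k₂ * o + k₃ * e ≈ x + (k₁ + k₂ * o + k₃ * e)
    regroup = solve-∀ Poly-ring

  -- The closed constant parts are checked by evaluation.
  L-entries : ∀ i j → L i j ≈ Mᶻᶜ i j + β j * 1ₚ + γ j * onSecondSide i
  L-entries i j with ↑-view n₁ i | ↑-view n₁ j
  ... | inj₁ (a , refl) | inj₁ (zero , refl) =
    entry-by-values (L-↑ˡ↑ˡ a zero) (Mᶻᶜ-z (a ↑ˡ n₂)) (β-↑ˡ zero) (γ-↑ˡ zero) (onSecondSide-↑ˡ a) ≈-refl
  ... | inj₂ (a , refl) | inj₁ (zero , refl) =
    entry-by-values (L-↑ʳ↑ˡ a zero) (Mᶻᶜ-z (n₁ ↑ʳ a)) (β-↑ˡ zero) (γ-↑ˡ zero) (onSecondSide-↑ʳ a) ≈-refl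
  ... | inj₁ (a , refl) | inj₂ (zero , refl) =
    entry-by-values (L-↑ˡ↑ʳ a zero) (trans (Mᶻᶜ-c (a ↑ˡ n₂)) (onSecondSide-↑ˡ a))
                    (β-↑ʳ zero) (γ-↑ʳ zero) (onSecondSide-↑ˡ a) ≈-refl
  ... | inj₂ (a , refl) | inj₂ (zero , refl) =
    entry-by-values (L-↑ʳ↑ʳ a zero) (trans (Mᶻᶜ-c (n₁ ↑ʳ a)) (onSecondSide-↑ʳ a))
                    (β-↑ʳ zero) (γ-↑ʳ zero) (onSecondSide-↑ʳ a) ≈-refl
  ... | inj₁ (a , refl) | inj₁ (suc b , refl) =
    entry-by-values (L-↑ˡ↑ˡ a (suc b)) (trans (Mᶻᶜ-first (a ↑ˡ n₂) b) (joinMatrix-↑ˡ↑ˡ a (suc b)))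
                    (β-↑ˡ (suc b)) (γ-↑ˡ (suc b)) (onSecondSide-↑ˡ a)
                    (absorb (Q₁ a (suc b)) (constₚ (+ 2)) (constₚ (- + 2)) 1ₚ []
                            (mk≈ λ { zero → refl ; (suc _) → refl }))
  ... | inj₂ (a , refl) | inj₁ (suc b , refl) =
    entry-by-values (L-↑ʳ↑ˡ a (suc b)) (trans (Mᶻᶜ-first (n₁ ↑ʳ a) b) (joinMatrix-↑ʳ↑ˡ a (suc b)))
                    (β-↑ˡ (suc b)) (γ-↑ˡ (suc b)) (onSecondSide-↑ʳ a)
                    (mk≈ λ { zero → refl ; (suc _) → refl })
  ... | inj₁ (a , refl) | inj₂ (suc b , refl) =
    entry-by-values (L-↑ˡ↑ʳ a (suc b)) (trans (Mᶻᶜ-second (a ↑ˡ n₂) b) (joinMatrix-↑ˡ↑ʳ a (suc b)))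
                    (β-↑ʳ (suc b)) (γ-↑ʳ (suc b)) (onSecondSide-↑ˡ a)
                    (mk≈ λ { zero → refl ; (suc _) → refl })
  ... | inj₂ (a , refl) | inj₂ (suc b , refl) =
    entry-by-values (L-↑ʳ↑ʳ a (suc b)) (trans (Mᶻᶜ-second (n₁ ↑ʳ a) b) (joinMatrix-↑ʳ↑ʳ a (suc b)))
                    (β-↑ʳ (suc b)) (γ-↑ʳ (suc b)) (onSecondSide-↑ʳ a)
                    (absorb (Q₂ a (suc b)) (constₚ (+ 2)) (constₚ (- + 1)) (constₚ (- + 1)) 1ₚ
                            (mk≈ λ { zero → refl ; (suc _) → refl }))

  det-L : detₚ L ≈ detₚ Mᶻᶜ
  det-L = det-addTwoPivotMultiples Mᶻᶜ L z c β γ (≡⇒≈ (β-↑ˡ zero)) (≡⇒≈ (β-↑ʳ zero)) (≡⇒≈ (γ-↑ʳ zero))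
    λ i j → ≈-trans (L-entries i j)
                    (≡⇒≈ (sym (cong₂ (λ u v → Mᶻᶜ i j + β j * u + γ j * v) (Mᶻᶜ-z i) (Mᶻᶜ-c i))))

  det-L-blocks : detₚ L ≈ detₚ (withOnes Q₁) * detₚ (withOnes Q₂)
  det-L-blocks = ≈-trans (det-blockLowerTriangular n₁ L λ a b → ≡⇒≈ (L-↑ˡ↑ʳ a b))
    (*-cong (det-cong λ a b → ≡⇒≈ (L-↑ˡ↑ˡ a b)) (det-cong λ a b → ≡⇒≈ (L-↑ʳ↑ʳ a b)))

  det-joinMatrix : detₚ M ≈ Xₚ * (X- (+ N) * (detₚ (withOnes Q₁) * detₚ (withOnes Q₂)))
  det-joinMatrix = begin
    detₚ M
      ≈⟨ det-M ⟩
    Xₚ * detₚ Mᶻ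
      ≈⟨ *-congˡ Xₚ det-Mᶻ ⟩
    Xₚ * (X- (+ N) * detₚ Mᶻᶜ)
      ≈⟨ *-congˡ Xₚ (*-congˡ (X- (+ N)) (≈-trans (≈-sym det-L) det-L-blocks)) ⟩
    Xₚ * (X- (+ N) * (detₚ (withOnes Q₁) * detₚ (withOnes Q₂))) ∎

distance-in-side : ∀ b → constₚ (+ (if b then 1 else 2)) ≈
                         negₚ (constₚ (if b then + 1 else + 0)) + constₚ (+ 2)
distance-in-side true  = ≈-refl
distance-in-side false = ≈-refl

module JoinSpectrum {m₁ m₂ : ℕ} (G₁ : Graph (suc m₁)) (G₂ : Graph (suc m₂)) (r₁ r₂ : ℕ)
                    (reg₁ : Regular G₁ r₁) (reg₂ : Regular G₂ r₂) where

  n₁ n₂ N : ℕ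
  n₁ = suc m₁
  n₂ = suc m₂
  N  = n₁ ℕ.+ n₂

  t₁ t₂ : ℤ
  t₁ = + n₁ ℤ.+ + n₁ ℤ.+ + n₂
  t₂ = + n₂ ℤ.+ + n₂ ℤ.+ + n₁

  module Shift₁ = RegularShift G₁ r₁ reg₁ t₁
  module Shift₂ = RegularShift G₂ r₂ reg₂ t₂

  Q₁ : PMat n₁
  Q₁ = Shift₁.Q

  Q₂ : PMat n₂
  Q₂ = Shift₂.Q

  open JoinDeterminant Q₁ Q₂ Shift₁.rowSum-Q Shift₂.rowSum-Q using (rowSum-M; det-joinMatrix)
  open JoinMatrix Q₁ Q₂

  D : PMat N
  D = charMatrix Xₚ (distLaplacian (join G₁ G₂))

  D-offDiagonal : ∀ i j → i ≢ j → D i j ≈ joinMatrix Q₁ Q₂ i j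
  D-offDiagonal i j i≢j with ↑-view n₁ i | ↑-view n₁ j
  ... | inj₁ (a , refl) | inj₁ (b , refl) = begin
    D (a ↑ˡ n₂) (b ↑ˡ n₂)
      ≈⟨ charMatrix-distLaplacian-off (join G₁ G₂) i≢j ⟩
    constₚ (+ dist (join G₁ G₂) (a ↑ˡ n₂) (b ↑ˡ n₂))
      ≡⟨ cong (constₚ ∘ +_) (dist-join-↑ˡ G₁ G₂ zero a≢b) ⟩
    constₚ (+ (if adj G₁ a b then 1 else 2))
      ≈⟨ distance-in-side (adj G₁ a b) ⟩
    negₚ (constₚ (adjMatrix G₁ a b)) + constₚ (+ 2)
      ≡⟨ cong (_+ constₚ (+ 2)) (charMatrix-offDiagonal _ (adjMatrix G₁) a≢b) ⟨
    Q₁ a b + constₚ (+ 2)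
      ≡⟨ joinMatrix-↑ˡ↑ˡ a b ⟨
    joinMatrix Q₁ Q₂ (a ↑ˡ n₂) (b ↑ˡ n₂) ∎
    where
    a≢b : a ≢ b
    a≢b = i≢j ∘ cong (_↑ˡ n₂)
  ... | inj₂ (a , refl) | inj₂ (b , refl) = begin
    D (n₁ ↑ʳ a) (n₁ ↑ʳ b)
      ≈⟨ charMatrix-distLaplacian-off (join G₁ G₂) i≢j ⟩
    constₚ (+ dist (join G₁ G₂) (n₁ ↑ʳ a) (n₁ ↑ʳ b))
      ≡⟨ cong (constₚ ∘ +_) (dist-join-↑ʳ G₁ G₂ zero a≢b) ⟩
    constₚ (+ (if adj G₂ a b then 1 else 2))
      ≈⟨ distance-in-side (adj G₂ a b) ⟩
    negₚ (constₚ (adjMatrix G₂ a b)) + constₚ (+ 2)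
      ≡⟨ cong (_+ constₚ (+ 2)) (charMatrix-offDiagonal _ (adjMatrix G₂) a≢b) ⟨
    Q₂ a b + constₚ (+ 2)
      ≡⟨ joinMatrix-↑ʳ↑ʳ a b ⟨
    joinMatrix Q₁ Q₂ (n₁ ↑ʳ a) (n₁ ↑ʳ b) ∎
    where
    a≢b : a ≢ b
    a≢b = i≢j ∘ cong (n₁ ↑ʳ_)
  ... | inj₁ (a , refl) | inj₂ (b , refl) =
    ≈-trans (charMatrix-distLaplacian-off (join G₁ G₂) i≢j)
            (≡⇒≈ (trans (cong (constₚ ∘ +_) (dist-join-↑ˡ↑ʳ G₁ G₂ a b)) (sym (joinMatrix-↑ˡ↑ʳ a b))))
  ... | inj₂ (a , refl) | inj₁ (b , refl) =
    ≈-trans (charMatrix-distLaplacian-off (join G₁ G₂) i≢j)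
            (≡⇒≈ (trans (cong (constₚ ∘ +_) (dist-join-↑ʳ↑ˡ G₁ G₂ b a)) (sym (joinMatrix-↑ʳ↑ˡ a b))))

  charPoly-join : charPoly (distLaplacian (join G₁ G₂)) ≈
                  X- (+ 0) * (X- (+ N) * (detₚ (withOnes Q₁) * detₚ (withOnes Q₂)))
  charPoly-join = ≈-trans (det-cong (≈-from-rowSums D (joinMatrix Q₁ Q₂) rowSums D-offDiagonal)) det-joinMatrix
    where
    rowSums : ∀ i → sumₚ (D i) ≈ sumₚ (joinMatrix Q₁ Q₂ i)
    rowSums i = ≈-trans (sumₚ-charMatrix-distLaplacian (join G₁ G₂) i) (≈-sym (rowSum-M i))

corollary3p1 : ∀ {n₁ n₂ : ℕ} (G₁ : Graph n₁) (G₂ : Graph n₂) (r₁ r₂ : ℕ) →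
    1 ≤ n₁ → 1 ≤ n₂ → Regular G₁ r₁ → Regular G₂ r₂ →
    DL-integral (join G₁ G₂) ⇔ (A-integral G₁ × A-integral G₂)
corollary3p1 {suc m₁} {suc m₂} G₁ G₂ r₁ r₂ (s≤s z≤n) (s≤s z≤n) reg₁ reg₂ =
  ⇔-trans (IntegralSpectrum⇔Splits (distLaplacian (join G₁ G₂)))
  (⇔-trans (Splits-twoRoots⇔ (+ 0) (+ N) t₁ t₂
              Shift₁.charPoly-∘X-Monic Shift₂.charPoly-∘X-Monic
              Shift₁.charPoly-∘X- Shift₂.charPoly-∘X- charPoly-join)
           (⇔-sym (IntegralSpectrum⇔Splits-∘X- (adjMatrix G₁) (t₁ ℤ.- + r₁)
                   ×-⇔ IntegralSpectrum⇔Splits-∘X- (adjMatrix G₂) (t₂ ℤ.- + r₂))))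
  where open JoinSpectrum G₁ G₂ r₁ r₂ reg₁ reg₂
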